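{- Let $T=(\mathcal{L},\mathcal{R})$ be a graph transformation system and $D\subseteq\mathcal{G}(\mathcal{L})$. If $T$ is terminating modulo garbage and weakly garbage separating with respect to $D$, and all its non-garbage critical pairs with respect to $D$ are strongly joinable, then $T$ is confluent modulo garbage with respect to $D$.
   Context: Fix a label alphabet $\mathcal{L}$ of finite sets; graphs $G=(V,E,s,t,l,m)$ are finite, totally labelled; morphisms preserve sources, targets, labels. Rules $r=\langle L\leftarrow K\rightarrow R\rangle$: graphs with $K$ a subgraph of $L$ and $R$. Direct derivation $G\Rightarrow_{r,g}H$: injective $g:L\to G$ satisfying the dangling condition (no edge outside $g(L)$ incident to $g(V_L\setminus V_K)$); intermediate graph $D_0=G\setminus g(L\setminus K)$ with inclusion $in:D_0\to G$, and $H$ obtained by gluing $R$ to $D_0$ along $K$ with $in':D_0\to H$. Track morphism $tr_{G\Rightarrow H}=in'\circ in^{ -1}$ (partial), composed along sequences. GT system: finite rule set; $\mathcal{G}(\mathcal{L})$: isomorphism classes. Critical pair: $H_1\Leftarrow_{r_1,g_1}G\Rightarrow_{r_2,g_2}H_2$ with $G=g_1(L_1)\cup g_2(L_2)$, $g_1(L_1)\cap g_2(L_2)\not\subseteq g_1(K_1)\cap g_2(K_2)$, and $g_1\ne g_2$ if $r_1=r_2$. Persistent nodes: $v\in V_G$ with nonempty track in both $H_1$ and $H_2$. Strongly joinable: there exist $M$ and $H_1\Rightarrow^*M\Leftarrow^*H_2$ such that every persistent node has equal nonempty tracks in $M$ along both derivations. $\overline{D}$: smallest set containing $D$ and closed under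 subgraphs; non-garbage pair: $[G]\in\overline{D}$. Weakly garbage separating: $[G]\in D$, $G\Rightarrow H$ imply $[H]\in D$. Terminating modulo garbage: no infinite derivation from a graph in $D$. Confluent modulo garbage: for all $G$ with $[G]\in D$, $H_1\Leftarrow^*G\Rightarrow^*H_2$ implies some $M$ with $H_1\Rightarrow^*M\Leftarrow^*H_2$. -}

module Defs where

open import Data.Nat using (ℕ)
open import Data.Fin using (Fin)
open import Data.Maybe using (Maybe; just; nothing; _>>=_)
open import Data.Product using (Σ; ∃; _×_; _,_)
open import Data.Sum using (_⊎_)
open import Relation.Nullary using (¬_)
open import Relation.Binary.PropositionalEquality using (_≡_; _≢_; subst)
open import Function.Definitions using (Injective)
open import Induction.WellFounded using (Acc)

record Alphabet : Set where
  field
    nLV nLE : ℕ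

record Graph (A : Alphabet) : Set where
  field
    nV nE : ℕ
    s t   : Fin nE → Fin nV
    lV    : Fin nV → Fin (Alphabet.nLV A)
    lE    : Fin nE → Fin (Alphabet.nLE A)

open Graph public

module _ {A : Alphabet} where

  Node Edge : Graph A → Set
  Node G = Fin (nV G)
  Edge G = Fin (nE G)

  record Morph (G H : Graph A) : Set where
    field
      fV : Node G → Node H
      fE : Edge G → Edge H
      pres-s  : ∀ e → fV (s G e) ≡ s H (fE e)
      pres-t  : ∀ e → fV (t G e) ≡ t H (fE e)
      pres-lV : ∀ v → lV H (fV v) ≡ lV G v
      pres-lE : ∀ e → lE H (fE e) ≡ lE G e

  open Morph public

  -- injective morphisms (G is, up to isomorphism, a subgraph of H)
  record InjMorph (G H : Graph A) : Set where
    field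
      mor  : Morph G H
      injV : Injective _≡_ _≡_ (fV mor)
      injE : Injective _≡_ _≡_ (fE mor)

  record Iso (G H : Graph A) : Set where
    field
      to   : Morph G H
      from : Morph H G
      invV₁ : ∀ v → fV from (fV to v) ≡ v
      invV₂ : ∀ w → fV to (fV from w) ≡ w
      invE₁ : ∀ e → fE from (fE to e) ≡ e
      invE₂ : ∀ e → fE to (fE from e) ≡ e

  SameMorph : {G H : Graph A} → Morph G H → Morph G H → Set
  SameMorph f g = (∀ v → fV f v ≡ fV g v) × (∀ e → fE f e ≡ fE g e)

  InImgV : {G H : Graph A} → Morph G H → Node H → Set
  InImgV f w = ∃ λ v → fV f v ≡ w

  InImgE : {G H : Graph A} → Morph G H → Edge H → Set
  InImgE f e' = ∃ λ e → fE f e ≡ e'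

record Rule (A : Alphabet) : Set where
  field
    L K R : Graph A
    kl : InjMorph K L
    kr : InjMorph K R

open Rule public

record GTS (A : Alphabet) : Set where
  field
    nR   : ℕ
    rule : Fin nR → Rule A

open GTS public

module _ {A : Alphabet} where

  -- H is characterised (up to isomorphism) as the result of deleting
  -- g(L \ K) from G (giving D₀, embedded into H by the track) and gluing
  -- R along K, the comatch being h : R → H.
  record DDer (r : Rule A) (G H : Graph A) : Set where
    private
      kL = InjMorph.mor (kl r)
      kR = InjMorph.mor (kr r)
    field
      g    : Morph (L r) G
      g-injV : Injective _≡_ _≡_ (fV g)
      g-injE : Injective _≡_ _≡_ (fE g)
    DelV : Node G → Set
    DelV v = ∃ λ x → ¬ InImgV kL x × fV g x ≡ v
    DelE : Edge G → Set
    DelE e = ∃ λ x → ¬ InImgE kL x × fE g x ≡ e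
    field
      dangling : ∀ e → ¬ InImgE g e → ¬ DelV (s G e) × ¬ DelV (t G e)
      -- track morphism tr = in' ∘ in⁻¹ : G ⇀ H
      trV : Node G → Maybe (Node H)
      trE : Edge G → Maybe (Edge H)
      trV-del  : ∀ v → DelV v → trV v ≡ nothing
      trV-keep : ∀ v → trV v ≡ nothing → DelV v
      trE-del  : ∀ e → DelE e → trE e ≡ nothing
      trE-keep : ∀ e → trE e ≡ nothing → DelE e
      trV-inj : ∀ {v v' w} → trV v ≡ just w → trV v' ≡ just w → v ≡ v'
      trE-inj : ∀ {e e' f} → trE e ≡ just f → trE e' ≡ just f → e ≡ e'
      trV-lab : ∀ {v w} → trV v ≡ just w → lV H w ≡ lV G v
      trE-lab : ∀ {e f} → trE e ≡ just f → lE H f ≡ lE G e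
      trE-s   : ∀ {e f} → trE e ≡ just f → trV (s G e) ≡ just (s H f)
      trE-t   : ∀ {e f} → trE e ≡ just f → trV (t G e) ≡ just (t H f)
      h      : Morph (R r) H
      h-injV : Injective _≡_ _≡_ (fV h)
      h-injE : Injective _≡_ _≡_ (fE h)
      comV : ∀ k → trV (fV g (fV kL k)) ≡ just (fV h (fV kR k))
      comE : ∀ k → trE (fE g (fE kL k)) ≡ just (fE h (fE kR k))
      disjV : ∀ x v → ¬ InImgV kR x → trV v ≢ just (fV h x)
      disjE : ∀ x e → ¬ InImgE kR x → trE e ≢ just (fE h x)
      coverV : ∀ w → (∃ λ v → trV v ≡ just w) ⊎ (∃ λ x → ¬ InImgV kR x × fV h x ≡ w)
      coverE : ∀ f → (∃ λ e → trE e ≡ just f) ⊎ (∃ λ x → ¬ InImgE kR x × fE h x ≡ f)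

  open DDer public

module _ {A : Alphabet} (T : GTS A) where

  _⇒_ : Graph A → Graph A → Set
  G ⇒ H = Σ (Fin (nR T)) λ i → DDer (rule T i) G H

  -- derivation sequences; a zero-step derivation relates isomorphic graphs
  -- (graphs are considered up to isomorphism)
  data _⇒*_ : Graph A → Graph A → Set where
    done : ∀ {G H} → Iso G H → G ⇒* H
    step : ∀ {G H M} → G ⇒ H → H ⇒* M → G ⇒* M

  trackV* : ∀ {G M} → G ⇒* M → Node G → Maybe (Node M)
  trackV* (done φ) v = just (fV (Iso.to φ) v)
  trackV* (step (i , d) p) v = trV d v >>= trackV* p

  IsoClosed : (Graph A → Set) → Set
  IsoClosed D = ∀ {G H} → Iso G H → D G → D H

  -- [G] ∈ D̄ : G is (isomorphic to) a subgraph of a graph in D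
  NonGarbage : (Graph A → Set) → Graph A → Set
  NonGarbage D G = ∃ λ H → D H × InjMorph G H

  WeaklyGarbageSeparating : (Graph A → Set) → Set
  WeaklyGarbageSeparating D = ∀ {G H} → D G → G ⇒ H → D H

  -- terminating modulo garbage: every derivation starting in D is finite
  -- (inductive / accessibility formulation)
  _⇐_ : Graph A → Graph A → Set
  H ⇐ G = G ⇒ H

  TerminatingModGarbage : (Graph A → Set) → Set
  TerminatingModGarbage D = ∀ G → D G → Acc _⇐_ G

  ConfluentModGarbage : (Graph A → Set) → Set
  ConfluentModGarbage D =
    ∀ {G H₁ H₂} → D G → G ⇒* H₁ → G ⇒* H₂ →
    ∃ λ M → (H₁ ⇒* M) × (H₂ ⇒* M)

  record CriticalPair : Set where
    field
      i₁ i₂  : Fin (nR T)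
      G H₁ H₂ : Graph A
      d₁ : DDer (rule T i₁) G H₁
      d₂ : DDer (rule T i₂) G H₂
    private
      g₁ = g d₁
      g₂ = g d₂
      k₁ = InjMorph.mor (kl (rule T i₁))
      k₂ = InjMorph.mor (kl (rule T i₂))
      InKV : Node G → Set
      InKV v = (∃ λ x → fV g₁ (fV k₁ x) ≡ v) × (∃ λ y → fV g₂ (fV k₂ y) ≡ v)
      InKE : Edge G → Set
      InKE e = (∃ λ x → fE g₁ (fE k₁ x) ≡ e) × (∃ λ y → fE g₂ (fE k₂ y) ≡ e)
    field
      unionV : ∀ v → InImgV g₁ v ⊎ InImgV g₂ v
      unionE : ∀ e → InImgE g₁ e ⊎ InImgE g₂ e
      conflict : (∃ λ v → InImgV g₁ v × InImgV g₂ v × ¬ InKV v)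
               ⊎ (∃ λ e → InImgE g₁ e × InImgE g₂ e × ¬ InKE e)
      distinct : (p : i₁ ≡ i₂) →
                 ¬ SameMorph (subst (λ j → Morph (L (rule T j)) G) p g₁) g₂

  open CriticalPair public

  NonGarbageCP : (Graph A → Set) → CriticalPair → Set
  NonGarbageCP D cp = NonGarbage D (G cp)

  Persistent : (cp : CriticalPair) → Node (G cp) → Set
  Persistent cp v = (∃ λ w₁ → trV (d₁ cp) v ≡ just w₁) × (∃ λ w₂ → trV (d₂ cp) v ≡ just w₂)

  StronglyJoinable : CriticalPair → Set
  StronglyJoinable cp =
    ∃ λ M → Σ (H₁ cp ⇒* M) λ p₁ → Σ (H₂ cp ⇒* M) λ p₂ →
      ∀ v → Persistent cp v →
        ∃ λ w → (trV (d₁ cp) v >>= trackV* p₁) ≡ just w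
              × (trV (d₂ cp) v >>= trackV* p₂) ≡ just w

-- Confluence modulo garbage follows from Newman's lemma relativised to D
-- (`newman`): D is closed under steps and admits no infinite derivations, so it
-- suffices to join every pair of one-step derivations H₁ ⇐ G ⇒ H₂ with G ∈ D
-- (`localConfluence`).  Such a pair is either
--  * parallel independent: the steps commute (local Church–Rosser,
--    `ParallelIndependence`);
--  * made of identical steps: the results are isomorphic (`derivationUnique`);
--  * conflicting and distinct: restricted to the union of the match images it is
--    a critical pair, non-garbage since G ∈ D, hence strongly joinable, and the
--    joining derivations extend back to H₁ and H₂ by the embedding theorem
--    (`CriticalOverlap`).
module Submission where

open import Defs
open import Data.Nat using (ℕ; zero; suc; _+_)
open import Data.Fin using (Fin; zero; suc; _↑ˡ_; _↑ʳ_; splitAt)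
open import Data.Fin.Properties using (↑ˡ-injective; ↑ʳ-injective; splitAt-↑ˡ; splitAt-↑ʳ; join-splitAt; any?; all?; _≟_; suc-injective; ¬∀⟶∃¬)
open import Data.Bool using (Bool; true; false)
open import Data.Maybe using (Maybe; just; nothing; _>>=_)
import Data.Maybe as Maybe
open import Data.Maybe.Properties using (just-injective)
open import Data.Product using (Σ; ∃; _×_; _,_; proj₁; proj₂)
open import Data.Sum using (_⊎_; inj₁; inj₂; [_,_]′)
import Data.Sum as Sum
open import Data.Empty using (⊥; ⊥-elim)
open import Relation.Nullary using (¬_; Dec; yes; no)
open import Relation.Nullary.Decidable using (¬?; _×-dec_; _⊎-dec_)
open import Relation.Binary.PropositionalEquality
open import Function.Definitions using (Injective)
open import Induction.WellFounded using (Acc; acc)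

DanglingCondition : {A : Alphabet} (r : Rule A) {G : Graph A} → Morph (L r) G → Set
DanglingCondition r {G} gg = ∀ e → ¬ InImgE gg e →
    ¬ (∃ λ x → ¬ InImgV (InjMorph.mor (kl r)) x × fV gg x ≡ s G e)
  × ¬ (∃ λ x → ¬ InImgV (InjMorph.mor (kl r)) x × fV gg x ≡ t G e)

module _ {A : Alphabet} where

  idMorph : (G : Graph A) → Morph G G
  idMorph G = record { fV = λ v → v ; fE = λ e → e ; pres-s = λ e → refl ; pres-t = λ e → refl
                 ; pres-lV = λ v → refl ; pres-lE = λ e → refl }

  _∘M_ : {G H K : Graph A} → Morph H K → Morph G H → Morph G K
  _∘M_ {G} {H} {K} f g = record
    { fV = λ v → fV f (fV g v) ; fE = λ e → fE f (fE g e)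
    ; pres-s = λ e → trans (cong (fV f) (pres-s g e)) (pres-s f (fE g e))
    ; pres-t = λ e → trans (cong (fV f) (pres-t g e)) (pres-t f (fE g e))
    ; pres-lV = λ v → trans (pres-lV f (fV g v)) (pres-lV g v)
    ; pres-lE = λ e → trans (pres-lE f (fE g e)) (pres-lE g e) }

  idIso : (G : Graph A) → Iso G G
  idIso G = record { to = idMorph G ; from = idMorph G ; invV₁ = λ _ → refl ; invV₂ = λ _ → refl
                   ; invE₁ = λ _ → refl ; invE₂ = λ _ → refl }

  symIso : {G H : Graph A} → Iso G H → Iso H G
  symIso φ = record { to = Iso.from φ ; from = Iso.to φ ; invV₁ = Iso.invV₂ φ ; invV₂ = Iso.invV₁ φ
                    ; invE₁ = Iso.invE₂ φ ; invE₂ = Iso.invE₁ φ }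

  transIso : {G H K : Graph A} → Iso G H → Iso H K → Iso G K
  transIso φ ψ = record
    { to = Iso.to ψ ∘M Iso.to φ ; from = Iso.from φ ∘M Iso.from ψ
    ; invV₁ = λ v → trans (cong (fV (Iso.from φ)) (Iso.invV₁ ψ _)) (Iso.invV₁ φ v)
    ; invV₂ = λ v → trans (cong (fV (Iso.to ψ)) (Iso.invV₂ φ _)) (Iso.invV₂ ψ v)
    ; invE₁ = λ v → trans (cong (fE (Iso.from φ)) (Iso.invE₁ ψ _)) (Iso.invE₁ φ v)
    ; invE₂ = λ v → trans (cong (fE (Iso.to ψ)) (Iso.invE₂ φ _)) (Iso.invE₂ ψ v) }

  -- A direct derivation from G is also one from any G' ≅ G, with the same result:
  -- compose the match with the isomorphism and the track with its inverse.
  -- Needed because derivation sequences identify isomorphic graphs.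
  transportSource : {r : Rule A} {G G' H : Graph A} → Iso G G' → DDer r G H → DDer r G' H
  transportSource {r} {G} {G'} {H} φ d = record
    { g = to ∘M g d
    ; g-injV = λ {x} {y} p → g-injV d (trans (sym (invV₁ _)) (trans (cong (fV from) p) (invV₁ _)))
    ; g-injE = λ {x} {y} p → g-injE d (trans (sym (invE₁ _)) (trans (cong (fE from) p) (invE₁ _)))
    ; dangling = dang
    ; trV = λ v → trV d (fV from v)
    ; trE = λ e → trE d (fE from e)
    ; trV-del = λ v del → trV-del d _ (delV→ v del)
    ; trV-keep = λ v p → delV← v (trV-keep d _ p)
    ; trE-del = λ v del → trE-del d _ (delE→ v del)
    ; trE-keep = λ v p → delE← v (trE-keep d _ p)
    ; trV-inj = λ p q → trans (sym (invV₂ _)) (trans (cong (fV to) (trV-inj d p q)) (invV₂ _))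
    ; trE-inj = λ p q → trans (sym (invE₂ _)) (trans (cong (fE to) (trE-inj d p q)) (invE₂ _))
    ; trV-lab = λ {v} p → trans (trV-lab d p) (pres-lV from v)
    ; trE-lab = λ {e} p → trans (trE-lab d p) (pres-lE from e)
    ; trE-s = λ {e} p → trans (cong (trV d) (pres-s from e)) (trE-s d p)
    ; trE-t = λ {e} p → trans (cong (trV d) (pres-t from e)) (trE-t d p)
    ; h = h d ; h-injV = h-injV d ; h-injE = h-injE d
    ; comV = λ k → trans (cong (trV d) (invV₁ _)) (comV d k)
    ; comE = λ k → trans (cong (trE d) (invE₁ _)) (comE d k)
    ; disjV = λ x v nx → disjV d x _ nx
    ; disjE = λ x v nx → disjE d x _ nx
    ; coverV = λ w → Sum.map (λ { (v , p) → fV to v , trans (cong (trV d) (invV₁ v)) p }) (λ z → z) (coverV d w)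
    ; coverE = λ w → Sum.map (λ { (v , p) → fE to v , trans (cong (trE d) (invE₁ v)) p }) (λ z → z) (coverE d w)
    }
    where
    open Iso φ
    kL = InjMorph.mor (kl r)
    delV→ : ∀ v → (∃ λ x → ¬ InImgV kL x × fV to (fV (g d) x) ≡ v) → DelV d (fV from v)
    delV→ v (x , nx , p) = x , nx , trans (sym (invV₁ _)) (cong (fV from) p)
    delV← : ∀ v → DelV d (fV from v) → (∃ λ x → ¬ InImgV kL x × fV to (fV (g d) x) ≡ v)
    delV← v (x , nx , p) = x , nx , trans (cong (fV to) p) (invV₂ v)
    delE→ : ∀ v → (∃ λ x → ¬ InImgE kL x × fE to (fE (g d) x) ≡ v) → DelE d (fE from v)
    delE→ v (x , nx , p) = x , nx , trans (sym (invE₁ _)) (cong (fE from) p)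
    delE← : ∀ v → DelE d (fE from v) → (∃ λ x → ¬ InImgE kL x × fE to (fE (g d) x) ≡ v)
    delE← v (x , nx , p) = x , nx , trans (cong (fE to) p) (invE₂ v)
    dang : DanglingCondition r (to ∘M g d)
    dang e ne =
      let nimg : ¬ InImgE (g d) (fE from e)
          nimg = λ { (x , p) → ne (x , trans (cong (fE to) p) (invE₂ e)) }
          (a , b) = dangling d (fE from e) nimg
      in (λ dl → a (subst (DelV d) (pres-s from e) (delV→ _ dl)))
       , (λ dl → b (subst (DelV d) (pres-t from e) (delV→ _ dl)))

module _ {A : Alphabet} (T : GTS A) where

  transportSequence : ∀ {G G' M} → Iso G G' → _⇒*_ T G M → _⇒*_ T G' M
  transportSequence φ (done ψ) = done (transIso (symIso φ) ψ)
  transportSequence φ (step (i , d) p) = step (i , transportSource φ d) p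

  _++*_ : ∀ {G H M} → _⇒*_ T G H → _⇒*_ T H M → _⇒*_ T G M
  done φ ++* q = transportSequence (symIso φ) q
  step d p ++* q = step d (p ++* q)

  LocallyConfluent : (Graph A → Set) → Set
  LocallyConfluent D = ∀ {G H₁ H₂} → D G → _⇒_ T G H₁ → _⇒_ T G H₂ → ∃ λ M → (_⇒*_ T H₁ M) × (_⇒*_ T H₂ M)

  -- For G ⇒ X₁ ⇒* H₁ and G ⇒ X₂ ⇒* H₂, join the first
  -- steps in N, join H₁ and N (from X₁) in M₁, then H₂ and M₁ (from X₂) in M.
  newman : (D : Graph A → Set) → WeaklyGarbageSeparating T D → LocallyConfluent D →
           ∀ {G} → Acc (_⇐_ T) G → D G → ∀ {H₁ H₂} → _⇒*_ T G H₁ → _⇒*_ T G H₂ →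
           ∃ λ M → (_⇒*_ T H₁ M) × (_⇒*_ T H₂ M)
  newman D wgs lconf _ _ (done φ) p₂ = _ , transportSequence φ p₂ , done (idIso _)
  newman D wgs lconf _ _ p₁@(step _ _) (done φ) = _ , done (idIso _) , transportSequence φ p₁
  newman D wgs lconf (acc below) dG (step d₁ q₁) (step d₂ q₂) =
    let (N , X₁⇒N , X₂⇒N) = lconf dG d₁ d₂
        (M₁ , H₁⇒M₁ , N⇒M₁) = newman D wgs lconf (below d₁) (wgs dG d₁) q₁ X₁⇒N
        (M , M₁⇒M , H₂⇒M) = newman D wgs lconf (below d₂) (wgs dG d₂) (X₂⇒N ++* N⇒M₁) q₂
    in M , (H₁⇒M₁ ++* M₁⇒M) , H₂⇒M

bind-inv : ∀ {X Y : Set} (m : Maybe X) (f : X → Maybe Y) {y} → (m >>= f) ≡ just y → ∃ λ x → m ≡ just x × f x ≡ just y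
bind-inv (just x) f e = x , refl , e

bind-assoc : ∀ {X Y Z : Set} (m : Maybe X) (f : X → Maybe Y) (g : Y → Maybe Z) → ((m >>= f) >>= g) ≡ (m >>= λ x → f x >>= g)
bind-assoc nothing f g = refl
bind-assoc (just x) f g = refl

just≢nothing : ∀ {X : Set} {x : X} → just x ≢ nothing
just≢nothing ()

defined : ∀ {X : Set} (m : Maybe X) → (m ≡ nothing → ⊥) → ∃ λ w → m ≡ just w
defined (just x) _ = x , refl
defined nothing f = ⊥-elim (f refl)

-- A covering (jointly surjective) description
-- determines X up to isomorphism by the identifications it makes: this is how
-- results of direct derivations are compared throughout the file.
module _ {A : Alphabet} where

  record Description (J : Set) (S : J → Graph A) (X : Graph A) : Set where
    field
      pV : (j : J) → Node (S j) → Maybe (Node X)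
      pE : (j : J) → Edge (S j) → Maybe (Edge X)
      ps : ∀ {j a f} → pE j a ≡ just f → pV j (s (S j) a) ≡ just (s X f)
      pt : ∀ {j a f} → pE j a ≡ just f → pV j (t (S j) a) ≡ just (t X f)
      plV : ∀ {j a x} → pV j a ≡ just x → lV X x ≡ lV (S j) a
      plE : ∀ {j a x} → pE j a ≡ just x → lE X x ≡ lE (S j) a
  open Description public

  module _ {J : Set} {S : J → Graph A} where

    Covers : {X : Graph A} → Description J S X → Set
    Covers {X} p = (∀ x → Σ J λ j → Σ (Node (S j)) λ a → pV p j a ≡ just x)
                 × (∀ x → Σ J λ j → Σ (Edge (S j)) λ a → pE p j a ≡ just x)

    Compatible : {X Y : Graph A} → Description J S X → Description J S Y → Set
    Compatible p q =
      (∀ {j a k b x} → pV p j a ≡ just x → pV p k b ≡ just x → ∃ λ y → pV q j a ≡ just y × pV q k b ≡ just y)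
      × (∀ {j a k b x} → pE p j a ≡ just x → pE p k b ≡ just x → ∃ λ y → pE q j a ≡ just y × pE q k b ≡ just y)

    module Induced {X Y : Graph A} (p : Description J S X) (cp : Covers p) (q : Description J S Y) (c : Compatible p q) where
      mV : Node X → Node Y
      mV x = proj₁ (proj₁ c (proj₂ (proj₂ (proj₁ cp x))) (proj₂ (proj₂ (proj₁ cp x))))
      mE : Edge X → Edge Y
      mE x = proj₁ (proj₂ c (proj₂ (proj₂ (proj₂ cp x))) (proj₂ (proj₂ (proj₂ cp x))))

      propV : ∀ {j a x} → pV p j a ≡ just x → pV q j a ≡ just (mV x)
      propV {j} {a} {x} e with proj₁ cp x
      ... | (k , b , e') with proj₁ c e' e' | proj₁ c e' e
      ... | (y , u , _) | (y' , u' , w') = trans w' (cong just (just-injective (trans (sym u') u)))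

      propE : ∀ {j a x} → pE p j a ≡ just x → pE q j a ≡ just (mE x)
      propE {j} {a} {x} e with proj₂ cp x
      ... | (k , b , e') with proj₂ c e' e' | proj₂ c e' e
      ... | (y , u , _) | (y' , u' , w') = trans w' (cong just (just-injective (trans (sym u') u)))

      mor : Morph X Y
      mor = record
        { fV = mV ; fE = mE
        ; pres-s = λ x → let (j , a , e) = proj₂ cp x in
                   just-injective (trans (sym (propV (ps p e))) (ps q (propE e)))
        ; pres-t = λ x → let (j , a , e) = proj₂ cp x in
                   just-injective (trans (sym (propV (pt p e))) (pt q (propE e)))
        ; pres-lV = λ x → let (j , a , e) = proj₁ cp x in trans (plV q (propV e)) (sym (plV p e))
        ; pres-lE = λ x → let (j , a , e) = proj₂ cp x in trans (plE q (propE e)) (sym (plE p e))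
        }

      injV : Compatible q p → Injective _≡_ _≡_ mV
      injV c' {x} {x'} eq =
        let (j , a , e) = proj₁ cp x
            (k , b , e') = proj₁ cp x'
            (z , u , w) = proj₁ c' (propV e) (trans (propV e') (cong just (sym eq)))
        in just-injective (trans (sym e) (trans u (trans (sym w) e')))

      injE : Compatible q p → Injective _≡_ _≡_ mE
      injE c' {x} {x'} eq =
        let (j , a , e) = proj₂ cp x
            (k , b , e') = proj₂ cp x'
            (z , u , w) = proj₂ c' (propE e) (trans (propE e') (cong just (sym eq)))
        in just-injective (trans (sym e) (trans u (trans (sym w) e')))

    descriptionEmbedding : {X Y : Graph A} (p : Description J S X) → Covers p → (q : Description J S Y) → Compatible p q → Compatible q p →
              Σ (InjMorph X Y) λ f →
                (∀ {j a x} → pV p j a ≡ just x → pV q j a ≡ just (fV (InjMorph.mor f) x))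
                × (∀ {j a x} → pE p j a ≡ just x → pE q j a ≡ just (fE (InjMorph.mor f) x))
    descriptionEmbedding p cp q c c' = record { mor = Induced.mor p cp q c ; injV = Induced.injV p cp q c c' ; injE = Induced.injE p cp q c c' }
                        , Induced.propV p cp q c , Induced.propE p cp q c

    descriptionIso : {X Y : Graph A} (p : Description J S X) → Covers p → (q : Description J S Y) → Covers q →
              Compatible p q → Compatible q p → Iso X Y
    descriptionIso p cp q cq c c' = record
      { to = Induced.mor p cp q c ; from = Induced.mor q cq p c'
      ; invV₁ = λ x → let (j , a , e) = proj₁ cp x in
                just-injective (trans (sym (Induced.propV q cq p c' (Induced.propV p cp q c e))) e)
      ; invV₂ = λ x → let (j , a , e) = proj₁ cq x in
                just-injective (trans (sym (Induced.propV p cp q c (Induced.propV q cq p c' e))) e)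
      ; invE₁ = λ x → let (j , a , e) = proj₂ cp x in
                just-injective (trans (sym (Induced.propE q cq p c' (Induced.propE p cp q c e))) e)
      ; invE₂ = λ x → let (j , a , e) = proj₂ cq x in
                just-injective (trans (sym (Induced.propE p cp q c (Induced.propE q cq p c' e))) e)
      }

record Enum (n : ℕ) (P : Fin n → Set) : Set where
  field
    k : ℕ
    emb : Fin k → Fin n
    embP : ∀ i → P (emb i)
    emb-inj : ∀ {i j} → emb i ≡ emb j → i ≡ j
    idx : ∀ v → P v → Fin k
    emb-idx : ∀ v p → emb (idx v p) ≡ v

enum : ∀ n (P : Fin n → Set) → (∀ v → Dec (P v)) → Enum n P
enum zero P d = record { k = 0 ; emb = λ () ; embP = λ () ; emb-inj = λ {i} → λ { {()} } ; idx = λ () ; emb-idx = λ () }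
enum (suc n) P d with d zero | enum n (λ v → P (suc v)) (λ v → d (suc v))
... | yes p0 | E = record
  { k = suc (Enum.k E)
  ; emb = em
  ; embP = eP
  ; emb-inj = ei
  ; idx = ix
  ; emb-idx = eix }
  where
  em : Fin (suc (Enum.k E)) → Fin (suc n)
  em zero = zero
  em (suc i) = suc (Enum.emb E i)
  eP : ∀ i → P (em i)
  eP zero = p0
  eP (suc i) = Enum.embP E i
  ei : ∀ {i j} → em i ≡ em j → i ≡ j
  ei {zero} {zero} e = refl
  ei {zero} {suc j} ()
  ei {suc i} {zero} ()
  ei {suc i} {suc j} e = cong suc (Enum.emb-inj E (suc-injective e))
  ix : ∀ v → P v → Fin (suc (Enum.k E))
  ix zero p = zero
  ix (suc v) p = suc (Enum.idx E v p)
  eix : ∀ v p → em (ix v p) ≡ v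
  eix zero p = refl
  eix (suc v) p = cong suc (Enum.emb-idx E v p)
... | no np0 | E = record
  { k = Enum.k E
  ; emb = λ i → suc (Enum.emb E i)
  ; embP = Enum.embP E
  ; emb-inj = λ e → Enum.emb-inj E (suc-injective e)
  ; idx = ix
  ; emb-idx = eix }
  where
  ix : ∀ v → P v → Fin (Enum.k E)
  ix zero p = ⊥-elim (np0 p)
  ix (suc v) p = Enum.idx E v p
  eix : ∀ v p → suc (Enum.emb E (ix v p)) ≡ v
  eix zero p = ⊥-elim (np0 p)
  eix (suc v) p = cong suc (Enum.emb-idx E v p)

idx-irr : ∀ {n P} (E : Enum n P) {v w} (p : P v) (q : P w) → v ≡ w → Enum.idx E v p ≡ Enum.idx E w q
idx-irr E p q e = Enum.emb-inj E (trans (Enum.emb-idx E _ p) (trans e (sym (Enum.emb-idx E _ q))))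

idx-emb : ∀ {n P} (E : Enum n P) i (p : P (Enum.emb E i)) → Enum.idx E (Enum.emb E i) p ≡ i
idx-emb E i p = Enum.emb-inj E (Enum.emb-idx E _ p)

data SplitV (m n : ℕ) : Fin (m + n) → Set where
  isL : (i : Fin m) → SplitV m n (i ↑ˡ n)
  isR : (j : Fin n) → SplitV m n (m ↑ʳ j)

splitV : ∀ m n (w : Fin (m + n)) → SplitV m n w
splitV m n w with splitAt m w | join-splitAt m n w
... | inj₁ i | e = subst (SplitV m n) e (isL i)
... | inj₂ j | e = subst (SplitV m n) e (isR j)

↑ˡ≢↑ʳ : ∀ {m n} (i : Fin m) (j : Fin n) → i ↑ˡ n ≢ m ↑ʳ j
↑ˡ≢↑ʳ {m} {n} i j e with trans (sym (splitAt-↑ˡ m i n)) (trans (cong (splitAt m) e) (splitAt-↑ʳ m n j))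
... | ()

caseLR : ∀ {m n} {X : Set} → (Fin m → X) → (Fin n → X) → Fin (m + n) → X
caseLR {m} f g w = [ f , g ]′ (splitAt m w)

caseLR-l : ∀ {m n} {X : Set} (f : Fin m → X) (g : Fin n → X) i → caseLR f g (i ↑ˡ n) ≡ f i
caseLR-l {m} {n} f g i = cong [ f , g ]′ (splitAt-↑ˡ m i n)

caseLR-r : ∀ {m n} {X : Set} (f : Fin m → X) (g : Fin n → X) j → caseLR f g (m ↑ʳ j) ≡ g j
caseLR-r {m} {n} f g j = cong [ f , g ]′ (splitAt-↑ʳ m n j)

-- Given a match
-- gm : L ↪ G and a span L ↩ K ↪ R, the result consists of the items of G that are
-- not deleted, followed by the items of R outside K.
module Gluing (nG nL nK nR : ℕ) (gm : Fin nL → Fin nG) (gm-inj : Injective _≡_ _≡_ gm)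
            (kl : Fin nK → Fin nL) (kl-inj : Injective _≡_ _≡_ kl)
            (kr : Fin nK → Fin nR) (kr-inj : Injective _≡_ _≡_ kr) where

  InK : Fin nL → Set
  InK x = ∃ λ k → kl k ≡ x
  InKR : Fin nR → Set
  InKR x = ∃ λ k → kr k ≡ x
  Del : Fin nG → Set
  Del v = ∃ λ x → ¬ InK x × gm x ≡ v

  InK? : ∀ x → Dec (InK x)
  InK? x = any? (λ k → kl k ≟ x)
  InKR? : ∀ x → Dec (InKR x)
  InKR? x = any? (λ k → kr k ≟ x)
  Del? : ∀ v → Dec (Del v)
  Del? v = any? (λ x → ¬? (InK? x) ×-dec (gm x ≟ v))

  EG : Enum nG (λ v → ¬ Del v)
  EG = enum nG _ (λ v → ¬? (Del? v))
  ER : Enum nR (λ x → ¬ InKR x)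
  ER = enum nR _ (λ x → ¬? (InKR? x))

  kG = Enum.k EG
  kRR = Enum.k ER
  nH = kG + kRR

  keepK : ∀ k → ¬ Del (gm (kl k))
  keepK k (x , nx , e) = nx (k , sym (gm-inj e))

  inG : ∀ v → ¬ Del v → Fin nH
  inG v p = Enum.idx EG v p ↑ˡ kRR

  inG-irr : ∀ {v w} p q → v ≡ w → inG v p ≡ inG w q
  inG-irr p q e = cong (_↑ˡ kRR) (idx-irr EG p q e)

  tr : Fin nG → Maybe (Fin nH)
  tr v with Del? v
  ... | yes _ = nothing
  ... | no p = just (inG v p)

  tr-just : ∀ v (p : ¬ Del v) → tr v ≡ just (inG v p)
  tr-just v p with Del? v
  ... | yes d = ⊥-elim (p d)
  ... | no p' = cong just (inG-irr p' p refl)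

  tr-del : ∀ v → Del v → tr v ≡ nothing
  tr-del v d with Del? v
  ... | yes _ = refl
  ... | no p = ⊥-elim (p d)

  tr-keep : ∀ v → tr v ≡ nothing → Del v
  tr-keep v e with Del? v
  ... | yes d = d
  ... | no p with e
  ... | ()

  tr-inv : ∀ {v w} → tr v ≡ just w → Σ (¬ Del v) λ p → inG v p ≡ w
  tr-inv {v} e with Del? v
  ... | yes _ with e
  ... | ()
  tr-inv {v} e | no p = p , just-injective e

  inG-inj : ∀ {v v'} p p' → inG v p ≡ inG v' p' → v ≡ v'
  inG-inj {v} {v'} p p' e = trans (sym (Enum.emb-idx EG v p))
     (trans (cong (Enum.emb EG) (↑ˡ-injective kRR _ _ e)) (Enum.emb-idx EG v' p'))

  tr-inj : ∀ {v v' w} → tr v ≡ just w → tr v' ≡ just w → v ≡ v'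
  tr-inj e e' with tr-inv e | tr-inv e'
  ... | (p , u) | (p' , u') = inG-inj p p' (trans u (sym u'))

  hm : Fin nR → Fin nH
  hm x with InKR? x
  ... | yes (k , _) = inG (gm (kl k)) (keepK k)
  ... | no n = kG ↑ʳ Enum.idx ER x n

  hm-K : ∀ k → hm (kr k) ≡ inG (gm (kl k)) (keepK k)
  hm-K k with InKR? (kr k)
  ... | yes (k' , e) = inG-irr _ _ (cong (λ z → gm (kl z)) (kr-inj e))
  ... | no n = ⊥-elim (n (k , refl))

  hm-N : ∀ x (n : ¬ InKR x) → hm x ≡ kG ↑ʳ Enum.idx ER x n
  hm-N x n with InKR? x
  ... | yes i = ⊥-elim (n i)
  ... | no n' = cong (kG ↑ʳ_) (idx-irr ER n' n refl)

  com : ∀ k → tr (gm (kl k)) ≡ just (hm (kr k))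
  com k = trans (tr-just _ (keepK k)) (cong just (sym (hm-K k)))

  disj : ∀ x v → ¬ InKR x → tr v ≢ just (hm x)
  disj x v n e with tr-inv e
  ... | (p , u) = ↑ˡ≢↑ʳ _ _ (trans u (hm-N x n))

  -- the comatch is injective since the match and K ↪ L are
  hm-inj : Injective _≡_ _≡_ hm
  hm-inj {x} {y} e = go (InKR? x) (InKR? y)
    where
    go : Dec (InKR x) → Dec (InKR y) → x ≡ y
    go (yes (k , ex)) (yes (k' , ey)) =
        let q = trans (sym (hm-K k)) (trans (cong hm ex) (trans e (trans (sym (cong hm ey)) (hm-K k'))))
        in trans (sym ex) (trans (cong kr (kl-inj (gm-inj (inG-inj (keepK k) (keepK k') q)))) ey)
    go (yes (k , ex)) (no ny) = ⊥-elim (↑ˡ≢↑ʳ _ _ (trans (sym (hm-K k)) (trans (cong hm ex) (trans e (hm-N y ny)))))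
    go (no nx) (yes (k' , ey)) = ⊥-elim (↑ˡ≢↑ʳ _ _ (trans (sym (hm-K k')) (trans (cong hm ey) (trans (sym e) (hm-N x nx)))))
    go (no nx) (no ny) = trans (sym (Enum.emb-idx ER x nx))
        (trans (cong (Enum.emb ER) (↑ʳ-injective kG _ _ (trans (sym (hm-N x nx)) (trans e (hm-N y ny)))))
        (Enum.emb-idx ER y ny))

  cover : ∀ w → (∃ λ v → tr v ≡ just w) ⊎ (∃ λ x → ¬ InKR x × hm x ≡ w)
  cover w with splitV kG kRR w
  ... | isL i = inj₁ (Enum.emb EG i , trans (tr-just _ (Enum.embP EG i)) (cong (λ z → just (z ↑ˡ kRR)) (idx-emb EG i _)))
  ... | isR j = inj₂ (Enum.emb ER j , Enum.embP ER j , trans (hm-N _ (Enum.embP ER j)) (cong (kG ↑ʳ_) (idx-emb ER j _)))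

  module Lab {X : Set} (lG : Fin nG → X) (lR : Fin nR → X) (lL : Fin nL → X) (lK : Fin nK → X)
             (pg : ∀ x → lG (gm x) ≡ lL x) (pkl : ∀ k → lL (kl k) ≡ lK k) (pkr : ∀ k → lR (kr k) ≡ lK k) where
    fL : Fin kG → X
    fL i = lG (Enum.emb EG i)
    fR : Fin kRR → X
    fR j = lR (Enum.emb ER j)
    lH : Fin nH → X
    lH = caseLR fL fR

    lH-inG : ∀ v p → lH (inG v p) ≡ lG v
    lH-inG v p = trans (caseLR-l fL fR _) (cong lG (Enum.emb-idx EG v p))

    lab-tr : ∀ {v w} → tr v ≡ just w → lH w ≡ lG v
    lab-tr e with tr-inv e
    ... | (p , u) = trans (cong lH (sym u)) (lH-inG _ p)

    lab-h : ∀ x → lH (hm x) ≡ lR x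
    lab-h x with InKR? x
    ... | yes (k , e) = trans (lH-inG _ (keepK k)) (trans (pg _) (trans (pkl k) (trans (sym (pkr k)) (cong lR e))))
    ... | no n = trans (caseLR-r fL fR _) (cong lR (Enum.emb-idx ER x n))

module Construct {A : Alphabet} (r : Rule A) (G : Graph A) (gg : Morph (L r) G)
   (ginjV : Injective _≡_ _≡_ (fV gg)) (ginjE : Injective _≡_ _≡_ (fE gg))
   (dang : DanglingCondition r gg) where

  kL = InjMorph.mor (kl r)
  kR = InjMorph.mor (kr r)
  Lr = L r
  Kr = K r
  Rr = R r

  module GV = Gluing (nV G) (nV Lr) (nV Kr) (nV Rr) (fV gg) ginjV (fV kL) (InjMorph.injV (kl r)) (fV kR) (InjMorph.injV (kr r))
  module GE = Gluing (nE G) (nE Lr) (nE Kr) (nE Rr) (fE gg) ginjE (fE kL) (InjMorph.injE (kl r)) (fE kR) (InjMorph.injE (kr r))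
  module LV = GV.Lab (lV G) (lV Rr) (lV Lr) (lV Kr) (pres-lV gg) (pres-lV kL) (pres-lV kR)
  module LE = GE.Lab (lE G) (lE Rr) (lE Lr) (lE Kr) (pres-lE gg) (pres-lE kL) (pres-lE kR)

  -- a kept edge has kept endpoints: by the dangling condition if it is outside the
  -- match, and because K is a subgraph of L otherwise
  keepEnd : (st : ∀ {X : Graph A} → Edge X → Node X)
            (pst : ∀ {X Y : Graph A} (f : Morph X Y) e → fV f (st {X} e) ≡ st {Y} (fE f e))
            (dg : ∀ e → ¬ InImgE gg e → ¬ GV.Del (st {G} e)) →
            ∀ e → ¬ GE.Del e → ¬ GV.Del (st {G} e)
  keepEnd st pst dg e ne with any? (λ x → fE gg x ≟ e)
  ... | no nimg = dg e nimg
  ... | yes (x , gx) with GE.InK? x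
  ... | no nk = ⊥-elim (ne (x , nk , gx))
  ... | yes (k , kx) = λ del → GV.keepK (st {Kr} k)
          (subst GV.Del (sym (trans (cong (fV gg) (trans (pst kL k) (cong st kx)))
                                    (trans (pst gg x) (cong st gx)))) del)

  keepS : ∀ e → ¬ GE.Del e → ¬ GV.Del (s G e)
  keepS = keepEnd (λ {X} → s X) (λ f → pres-s f) (λ e n → proj₁ (dang e n))
  keepT : ∀ e → ¬ GE.Del e → ¬ GV.Del (t G e)
  keepT = keepEnd (λ {X} → t X) (λ f → pres-t f) (λ e n → proj₂ (dang e n))

  sL : Fin GE.kG → Fin GV.nH
  sL i = GV.inG (s G (Enum.emb GE.EG i)) (keepS _ (Enum.embP GE.EG i))
  sR : Fin GE.kRR → Fin GV.nH
  sR j = GV.hm (s Rr (Enum.emb GE.ER j))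
  tL : Fin GE.kG → Fin GV.nH
  tL i = GV.inG (t G (Enum.emb GE.EG i)) (keepT _ (Enum.embP GE.EG i))
  tR : Fin GE.kRR → Fin GV.nH
  tR j = GV.hm (t Rr (Enum.emb GE.ER j))

  H : Graph A
  H = record { nV = GV.nH ; nE = GE.nH ; s = caseLR sL sR ; t = caseLR tL tR ; lV = LV.lH ; lE = LE.lH }

  trE-s' : ∀ {e f} → GE.tr e ≡ just f → GV.tr (s G e) ≡ just (s H f)
  trE-s' {e} {f} eq with GE.tr-inv eq
  ... | (p , refl) = trans (GV.tr-just _ (keepS e p))
       (cong just (trans (GV.inG-irr _ _ (cong (s G) (sym (Enum.emb-idx GE.EG e p)))) (sym (caseLR-l sL sR _))))
  trE-t' : ∀ {e f} → GE.tr e ≡ just f → GV.tr (t G e) ≡ just (t H f)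
  trE-t' {e} {f} eq with GE.tr-inv eq
  ... | (p , refl) = trans (GV.tr-just _ (keepT e p))
       (cong just (trans (GV.inG-irr _ _ (cong (t G) (sym (Enum.emb-idx GE.EG e p)))) (sym (caseLR-l tL tR _))))

  hs : ∀ a → GV.hm (s Rr a) ≡ s H (GE.hm a)
  hs a = go (GE.InKR? a)
    where
    go : Dec (GE.InKR a) → GV.hm (s Rr a) ≡ s H (GE.hm a)
    go (yes (k , refl)) = trans (cong GV.hm (sym (pres-s kR k)))
        (trans (GV.hm-K (s Kr k))
        (trans (GV.inG-irr _ _ (trans (cong (fV gg) (pres-s kL k))
                  (trans (pres-s gg (fE kL k)) (cong (s G) (sym (Enum.emb-idx GE.EG _ (GE.keepK k)))))))
        (sym (trans (cong (s H) (GE.hm-K k)) (caseLR-l sL sR _)))))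
    go (no n) = sym (trans (cong (s H) (GE.hm-N a n)) (trans (caseLR-r sL sR _) (cong (λ z → GV.hm (s Rr z)) (Enum.emb-idx GE.ER a n))))

  ht : ∀ a → GV.hm (t Rr a) ≡ t H (GE.hm a)
  ht a = go (GE.InKR? a)
    where
    go : Dec (GE.InKR a) → GV.hm (t Rr a) ≡ t H (GE.hm a)
    go (yes (k , refl)) = trans (cong GV.hm (sym (pres-t kR k)))
        (trans (GV.hm-K (t Kr k))
        (trans (GV.inG-irr _ _ (trans (cong (fV gg) (pres-t kL k))
                  (trans (pres-t gg (fE kL k)) (cong (t G) (sym (Enum.emb-idx GE.EG _ (GE.keepK k)))))))
        (sym (trans (cong (t H) (GE.hm-K k)) (caseLR-l tL tR _)))))
    go (no n) = sym (trans (cong (t H) (GE.hm-N a n)) (trans (caseLR-r tL tR _) (cong (λ z → GV.hm (t Rr z)) (Enum.emb-idx GE.ER a n))))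

  hM : Morph Rr H
  hM = record { fV = GV.hm ; fE = GE.hm ; pres-s = hs ; pres-t = ht ; pres-lV = LV.lab-h ; pres-lE = LE.lab-h }

  dd : DDer r G H
  dd = record
    { g = gg ; g-injV = ginjV ; g-injE = ginjE ; dangling = dang
    ; trV = GV.tr ; trE = GE.tr
    ; trV-del = GV.tr-del ; trV-keep = GV.tr-keep ; trE-del = GE.tr-del ; trE-keep = GE.tr-keep
    ; trV-inj = GV.tr-inj ; trE-inj = GE.tr-inj
    ; trV-lab = LV.lab-tr ; trE-lab = LE.lab-tr
    ; trE-s = trE-s' ; trE-t = trE-t'
    ; h = hM ; h-injV = GV.hm-inj ; h-injE = GE.hm-inj
    ; comV = GV.com ; comE = GE.com
    ; disjV = GV.disj ; disjE = GE.disj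
    ; coverV = GV.cover ; coverE = GE.cover }

-- Existence of direct derivations.  The construction is opaque: later arguments
-- only use the axioms of direct derivations.
opaque
  derivationExists : {A : Alphabet} (r : Rule A) (G : Graph A) (gg : Morph (L r) G)
     (ginjV : Injective _≡_ _≡_ (fV gg)) (ginjE : Injective _≡_ _≡_ (fE gg))
     (dang : DanglingCondition r gg) →
     Σ (Graph A) λ H → Σ (DDer r G H) λ d → SameMorph (g d) gg
  derivationExists r G gg ginjV ginjE dang = Construct.H r G gg ginjV ginjE dang , Construct.dd r G gg ginjV ginjE dang , (λ _ → refl) , (λ _ → refl)

-- The node part and the edge part of a direct derivation satisfy the same axioms;
-- a SortView packages one of them so that sort-generic arguments are written once.
record SortView (IL IK IR : Set) (kl : IK → IL) (kr : IK → IR) (IG IH : Set) : Set where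
  field
    gm : IL → IG
    hm : IR → IH
    tr : IG → Maybe IH
    gm-inj : ∀ {x y} → gm x ≡ gm y → x ≡ y
    kr? : ∀ x → Dec (∃ λ k → kr k ≡ x)
    del? : ∀ v → Dec (∃ λ x → ¬ (∃ λ k → kl k ≡ x) × gm x ≡ v)
    tr-del : ∀ v → (∃ λ x → ¬ (∃ λ k → kl k ≡ x) × gm x ≡ v) → tr v ≡ nothing
    tr-keep : ∀ v → tr v ≡ nothing → (∃ λ x → ¬ (∃ λ k → kl k ≡ x) × gm x ≡ v)
    tr-inj : ∀ {v v' w} → tr v ≡ just w → tr v' ≡ just w → v ≡ v'
    hm-inj : ∀ {x y} → hm x ≡ hm y → x ≡ y
    com : ∀ k → tr (gm (kl k)) ≡ just (hm (kr k))
    disj : ∀ x v → ¬ (∃ λ k → kr k ≡ x) → tr v ≢ just (hm x)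

module _ {A : Alphabet} {r : Rule A} where
  nodeView : ∀ {G H} → DDer r G H → SortView (Node (L r)) (Node (K r)) (Node (R r)) (fV (InjMorph.mor (kl r))) (fV (InjMorph.mor (kr r))) (Node G) (Node H)
  nodeView {G} {H} d = record { gm = fV (g d)
    ; hm = fV (h d) ; tr = trV d ; gm-inj = g-injV d
    ; kr? = λ x → any? (λ k → fV (InjMorph.mor (kr r)) k ≟ x)
    ; del? = λ v → any? (λ x → ¬? (any? (λ k → fV (InjMorph.mor (kl r)) k ≟ x)) ×-dec (fV (g d) x ≟ v))
    ; tr-del = trV-del d ; tr-keep = trV-keep d ; tr-inj = trV-inj d ; hm-inj = h-injV d
    ; com = comV d ; disj = disjV d }
  edgeView : ∀ {G H} → DDer r G H → SortView (Edge (L r)) (Edge (K r)) (Edge (R r)) (fE (InjMorph.mor (kl r))) (fE (InjMorph.mor (kr r))) (Edge G) (Edge H)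
  edgeView {G} {H} d = record { gm = fE (g d)
    ; hm = fE (h d) ; tr = trE d ; gm-inj = g-injE d
    ; kr? = λ x → any? (λ k → fE (InjMorph.mor (kr r)) k ≟ x)
    ; del? = λ v → any? (λ x → ¬? (any? (λ k → fE (InjMorph.mor (kl r)) k ≟ x)) ×-dec (fE (g d) x ≟ v))
    ; tr-del = trE-del d ; tr-keep = trE-keep d ; tr-inj = trE-inj d ; hm-inj = h-injE d
    ; com = comE d ; disj = disjE d }

-- Two steps with the same rule whose matches are related by an injective map e.
-- Describing both results by (items of the small source) ⊎ R, the two descriptions
-- make the same identifications.
module CompareSteps {IL IK IR : Set} {kl : IK → IL} {kr : IK → IR} {IGa IHa IGb IHb : Set}
           (a : SortView IL IK IR kl kr IGa IHa) (b : SortView IL IK IR kl kr IGb IHb)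
           (e : IGa → IGb) (e-inj : ∀ {x y} → e x ≡ e y → x ≡ y)
           (ge : ∀ x → SortView.gm b x ≡ e (SortView.gm a x)) where
  module a = SortView a
  module b = SortView b


  p : IGa ⊎ IR → Maybe IHa
  p (inj₁ v) = a.tr v
  p (inj₂ x) = just (a.hm x)
  q : IGa ⊎ IR → Maybe IHb
  q (inj₁ v) = b.tr (e v)
  q (inj₂ x) = just (b.hm x)

  delSB : ∀ v → (∃ λ x → ¬ (∃ λ k → kl k ≡ x) × a.gm x ≡ v) → (∃ λ x → ¬ (∃ λ k → kl k ≡ x) × b.gm x ≡ e v)
  delSB v (x , nx , gx) = x , nx , trans (ge x) (cong e gx)
  delBS : ∀ v → (∃ λ x → ¬ (∃ λ k → kl k ≡ x) × b.gm x ≡ e v) → (∃ λ x → ¬ (∃ λ k → kl k ≡ x) × a.gm x ≡ v)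
  delBS v (x , nx , gx) = x , nx , e-inj (trans (sym (ge x)) gx)

  defB : ∀ v y → a.tr v ≡ just y → ∃ λ z → b.tr (e v) ≡ just z
  defB v y eq with b.tr (e v) in eq'
  ... | just z = z , refl
  ... | nothing with trans (sym eq) (a.tr-del v (delBS v (b.tr-keep (e v) eq')))
  ... | ()

  defA : ∀ v y → b.tr (e v) ≡ just y → ∃ λ z → a.tr v ≡ just z
  defA v y eq with a.tr v in eq'
  ... | just z = z , refl
  ... | nothing with trans (sym eq) (b.tr-del (e v) (delSB v (a.tr-keep v eq')))
  ... | ()

  mixA : ∀ v x → a.tr v ≡ just (a.hm x) → ∃ λ k → kr k ≡ x × v ≡ a.gm (kl k)
  mixA v x eq with SortView.kr? a x
  ... | no n = ⊥-elim (a.disj x v n eq)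
  ... | yes (k , w) = k , w , a.tr-inj eq (trans (a.com k) (cong (λ z → just (a.hm z)) w))

  mixB : ∀ v x → b.tr (e v) ≡ just (b.hm x) → ∃ λ k → kr k ≡ x × v ≡ a.gm (kl k)
  mixB v x eq with SortView.kr? b x
  ... | no n = ⊥-elim (b.disj x (e v) n eq)
  ... | yes (k , w) = k , w , e-inj (trans (b.tr-inj eq (trans (b.com k) (cong (λ z → just (b.hm z)) w)))
                                   (ge _))

  qAtK : ∀ k → q (inj₁ (a.gm (kl k))) ≡ just (b.hm (kr k))
  qAtK k = trans (cong b.tr (sym (ge _))) (b.com k)

  pAtK : ∀ k → p (inj₁ (a.gm (kl k))) ≡ just (a.hm (kr k))
  pAtK k = a.com k

  compPQ : ∀ i j y → p i ≡ just y → p j ≡ just y → ∃ λ z → q i ≡ just z × q j ≡ just z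
  compPQ (inj₁ v) (inj₁ w) y ev ew with a.tr-inj ev ew
  ... | refl = let (z , ez) = defB v y ev in z , ez , ez
  compPQ (inj₂ x) (inj₂ x') y ev ew with a.hm-inj (just-injective (trans ev (sym ew)))
  ... | refl = b.hm x , refl , refl
  compPQ (inj₁ v) (inj₂ x) y ev ew with mixA v x (trans ev (sym ew))
  ... | (k , refl , refl) = b.hm (kr k) , qAtK k , refl
  compPQ (inj₂ x) (inj₁ v) y ev ew with mixA v x (trans ew (sym ev))
  ... | (k , refl , refl) = b.hm (kr k) , refl , qAtK k

  compQP : ∀ i j y → q i ≡ just y → q j ≡ just y → ∃ λ z → p i ≡ just z × p j ≡ just z
  compQP (inj₁ v) (inj₁ w) y ev ew with e-inj (b.tr-inj ev ew)
  ... | refl = let (z , ez) = defA v y ev in z , ez , ez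
  compQP (inj₂ x) (inj₂ x') y ev ew with b.hm-inj (just-injective (trans ev (sym ew)))
  ... | refl = a.hm x , refl , refl
  compQP (inj₁ v) (inj₂ x) y ev ew with mixB v x (trans ev (sym ew))
  ... | (k , refl , refl) = a.hm (kr k) , pAtK k , refl
  compQP (inj₂ x) (inj₁ v) y ev ew with mixB v x (trans ew (sym ev))
  ... | (k , refl , refl) = a.hm (kr k) , refl , pAtK k

module _ {A : Alphabet} {r : Rule A} where

  StepParts : Graph A → Bool → Graph A
  StepParts X true = X
  StepParts X false = R r

  stepDescription : ∀ {X' X Y} → DDer r X Y → Morph X' X → Description Bool (StepParts X') Y
  stepDescription {X'} {X} {Y} d e = record
    { pV = pv ; pE = pe ; ps = λ {j} {a} → ps' {j} {a} ; pt = λ {j} {a} → pt' {j} {a} ; plV = λ {j} {a} → plv {j} {a} ; plE = λ {j} {a} → ple {j} {a} }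
    where
    pv : (j : Bool) → Node (StepParts X' j) → Maybe (Node Y)
    pv true v = trV d (fV e v)
    pv false x = just (fV (h d) x)
    pe : (j : Bool) → Edge (StepParts X' j) → Maybe (Edge Y)
    pe true v = trE d (fE e v)
    pe false x = just (fE (h d) x)
    ps' : ∀ {j a f} → pe j a ≡ just f → pv j (s (StepParts X' j) a) ≡ just (s Y f)
    ps' {true} {a} eq = trans (cong (trV d) (pres-s e a)) (trE-s d eq)
    ps' {false} {a} eq = trans (cong just (pres-s (h d) a)) (cong (λ z → just (s Y z)) (just-injective eq))
    pt' : ∀ {j a f} → pe j a ≡ just f → pv j (t (StepParts X' j) a) ≡ just (t Y f)
    pt' {true} {a} eq = trans (cong (trV d) (pres-t e a)) (trE-t d eq)
    pt' {false} {a} eq = trans (cong just (pres-t (h d) a)) (cong (λ z → just (t Y z)) (just-injective eq))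
    plv : ∀ {j a x} → pv j a ≡ just x → lV Y x ≡ lV (StepParts X' j) a
    plv {true} {a} eq = trans (trV-lab d eq) (pres-lV e a)
    plv {false} {a} eq = trans (cong (lV Y) (sym (just-injective eq))) (pres-lV (h d) a)
    ple : ∀ {j a x} → pe j a ≡ just x → lE Y x ≡ lE (StepParts X' j) a
    ple {true} {a} eq = trans (trE-lab d eq) (pres-lE e a)
    ple {false} {a} eq = trans (cong (lE Y) (sym (just-injective eq))) (pres-lE (h d) a)

  stepDescriptionCovers : ∀ {X Y} (d : DDer r X Y) → Covers (stepDescription d (idMorph X))
  stepDescriptionCovers d = cv , ce
    where
    cv : ∀ w → _
    cv w with coverV d w
    ... | inj₁ (v , eq) = true , v , eq
    ... | inj₂ (x , _ , eq) = false , x , cong just eq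
    ce : ∀ w → _
    ce w with coverE d w
    ... | inj₁ (v , eq) = true , v , eq
    ... | inj₂ (x , _ , eq) = false , x , cong just eq


  module CompareDerivations {X' X Y' Y} (d' : DDer r X' Y') (d : DDer r X Y) (e : InjMorph X' X)
     (geV : ∀ x → fV (g d) x ≡ fV (InjMorph.mor e) (fV (g d') x))
     (geE : ∀ x → fE (g d) x ≡ fE (InjMorph.mor e) (fE (g d') x)) where
    em = InjMorph.mor e
    module CV = CompareSteps (nodeView d') (nodeView d) (fV em) (InjMorph.injV e) geV
    module CE = CompareSteps (edgeView d') (edgeView d) (fE em) (InjMorph.injE e) geE
    p = stepDescription d' (idMorph X')
    q = stepDescription d em

    c1 : Compatible p q
    c1 = (λ {j} {a} {k} {b} → cv j a k b) , (λ {j} {a} {k} {b} → ce j a k b)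
      where
      cv : ∀ j a k b {x} → pV p j a ≡ just x → pV p k b ≡ just x → ∃ λ y → pV q j a ≡ just y × pV q k b ≡ just y
      cv true a true b = CV.compPQ (inj₁ a) (inj₁ b) _
      cv true a false b = CV.compPQ (inj₁ a) (inj₂ b) _
      cv false a true b = CV.compPQ (inj₂ a) (inj₁ b) _
      cv false a false b = CV.compPQ (inj₂ a) (inj₂ b) _
      ce : ∀ j a k b {x} → pE p j a ≡ just x → pE p k b ≡ just x → ∃ λ y → pE q j a ≡ just y × pE q k b ≡ just y
      ce true a true b = CE.compPQ (inj₁ a) (inj₁ b) _
      ce true a false b = CE.compPQ (inj₁ a) (inj₂ b) _
      ce false a true b = CE.compPQ (inj₂ a) (inj₁ b) _
      ce false a false b = CE.compPQ (inj₂ a) (inj₂ b) _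

    c2 : Compatible q p
    c2 = (λ {j} {a} {k} {b} → cv j a k b) , (λ {j} {a} {k} {b} → ce j a k b)
      where
      cv : ∀ j a k b {x} → pV q j a ≡ just x → pV q k b ≡ just x → ∃ λ y → pV p j a ≡ just y × pV p k b ≡ just y
      cv true a true b = CV.compQP (inj₁ a) (inj₁ b) _
      cv true a false b = CV.compQP (inj₁ a) (inj₂ b) _
      cv false a true b = CV.compQP (inj₂ a) (inj₁ b) _
      cv false a false b = CV.compQP (inj₂ a) (inj₂ b) _
      ce : ∀ j a k b {x} → pE q j a ≡ just x → pE q k b ≡ just x → ∃ λ y → pE p j a ≡ just y × pE p k b ≡ just y
      ce true a true b = CE.compQP (inj₁ a) (inj₁ b) _
      ce true a false b = CE.compQP (inj₁ a) (inj₂ b) _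
      ce false a true b = CE.compQP (inj₂ a) (inj₁ b) _
      ce false a false b = CE.compQP (inj₂ a) (inj₂ b) _

    result : Σ (InjMorph Y' Y) λ f →
              (∀ {v w} → trV d' v ≡ just w → trV d (fV em v) ≡ just (fV (InjMorph.mor f) w))
            × (∀ x → fV (InjMorph.mor f) (fV (h d') x) ≡ fV (h d) x)
            × (∀ {v w} → trE d' v ≡ just w → trE d (fE em v) ≡ just (fE (InjMorph.mor f) w))
            × (∀ x → fE (InjMorph.mor f) (fE (h d') x) ≡ fE (h d) x)
    result = let (f , pv , pe) = descriptionEmbedding p (stepDescriptionCovers d') q c1 c2
             in f , (λ {v} eq → pv {true} {v} eq) , (λ x → sym (just-injective (pv {false} {x} refl)))
                  , (λ {v} eq → pe {true} {v} eq) , (λ x → sym (just-injective (pe {false} {x} refl)))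

  derivationUnique : ∀ {X Y Y'} (d' : DDer r X Y') (d : DDer r X Y) → SameMorph (g d) (g d') →
            Σ (Iso Y' Y) λ φ → ∀ {v w} → trV d' v ≡ just w → trV d v ≡ just (fV (Iso.to φ) w)
  derivationUnique {X} d' d (sv , se) =
    let module S = CompareDerivations d' d (record { mor = idMorph X ; injV = λ z → z ; injE = λ z → z }) sv se
        cq : Covers S.q
        cq = stepDescriptionCovers d
        φ = descriptionIso S.p (stepDescriptionCovers d') S.q cq S.c1 S.c2
    in φ , λ {v} eq → Induced.propV S.p (stepDescriptionCovers d') S.q S.c1 {true} {v} eq

module _ {A : Alphabet} {r₁ r₂ : Rule A} {G H₁ H₂ : Graph A} (d₁ : DDer r₁ G H₁) (d₂ : DDer r₂ G H₂) where

  PreservedByBothV : Node G → Set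
  PreservedByBothV v = (∃ λ x → fV (g d₁) (fV (InjMorph.mor (kl r₁)) x) ≡ v)
                     × (∃ λ y → fV (g d₂) (fV (InjMorph.mor (kl r₂)) y) ≡ v)

  PreservedByBothE : Edge G → Set
  PreservedByBothE e = (∃ λ x → fE (g d₁) (fE (InjMorph.mor (kl r₁)) x) ≡ e)
                     × (∃ λ y → fE (g d₂) (fE (InjMorph.mor (kl r₂)) y) ≡ e)

  IndependentV : Set
  IndependentV = ∀ {v x y} → fV (g d₁) x ≡ v → fV (g d₂) y ≡ v → PreservedByBothV v

  IndependentE : Set
  IndependentE = ∀ {e x y} → fE (g d₁) x ≡ e → fE (g d₂) y ≡ e → PreservedByBothE e

  Conflict : Set
  Conflict = (∃ λ v → InImgV (g d₁) v × InImgV (g d₂) v × ¬ PreservedByBothV v)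
           ⊎ (∃ λ e → InImgE (g d₁) e × InImgE (g d₂) e × ¬ PreservedByBothE e)

module _ {A : Alphabet} {r₁ r₂ : Rule A} {G H₁ H₂ : Graph A} (d₁ : DDer r₁ G H₁) (d₂ : DDer r₂ G H₂) where

  independentV-sym : IndependentV d₁ d₂ → IndependentV d₂ d₁
  independentV-sym ind x₂ x₁ = let (p₁ , p₂) = ind x₁ x₂ in p₂ , p₁

  independentE-sym : IndependentE d₁ d₂ → IndependentE d₂ d₁
  independentE-sym ind x₂ x₁ = let (p₁ , p₂) = ind x₁ x₂ in p₂ , p₁

impl3 : ∀ {P Q R : Set} → Dec P → Dec Q → Dec R → Dec (P → Q → R)
impl3 (no np) _ _ = yes λ p _ → ⊥-elim (np p)
impl3 (yes p) (no nq) _ = yes λ _ q → ⊥-elim (nq q)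
impl3 (yes p) (yes q) (yes r) = yes λ _ _ → r
impl3 (yes p) (yes q) (no nr) = no λ f → nr (f p q)

witness3 : ∀ {P Q R : Set} → Dec P → Dec Q → ¬ (P → Q → R) → P × Q × ¬ R
witness3 (no np) _ f = ⊥-elim (f λ p → ⊥-elim (np p))
witness3 (yes p) (no nq) f = ⊥-elim (f λ _ q → ⊥-elim (nq q))
witness3 (yes p) (yes q) f = p , q , λ r → f λ _ _ → r

-- Two steps from the same graph are parallel independent or in conflict; this is
-- decidable as all graphs are finite.
independentOrConflict : ∀ {A : Alphabet} {r₁ r₂ : Rule A} {G H₁ H₂ : Graph A} (d₁ : DDer r₁ G H₁) (d₂ : DDer r₂ G H₂) →
                        (IndependentV d₁ d₂ × IndependentE d₁ d₂) ⊎ Conflict d₁ d₂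
independentOrConflict {r₁ = r₁} {r₂} {G} d₁ d₂ = combine (all? overlapV?) (all? overlapE?)
  where
  OverlapV : Node G → Set
  OverlapV v = InImgV (g d₁) v → InImgV (g d₂) v → PreservedByBothV d₁ d₂ v
  OverlapE : Edge G → Set
  OverlapE e = InImgE (g d₁) e → InImgE (g d₂) e → PreservedByBothE d₁ d₂ e
  inImgV₁? = λ v → any? (λ x → fV (g d₁) x ≟ v)
  inImgV₂? = λ v → any? (λ x → fV (g d₂) x ≟ v)
  inImgE₁? = λ e → any? (λ x → fE (g d₁) x ≟ e)
  inImgE₂? = λ e → any? (λ x → fE (g d₂) x ≟ e)
  overlapV? : ∀ v → Dec (OverlapV v)
  overlapV? v = impl3 (inImgV₁? v) (inImgV₂? v)
    (any? (λ x → fV (g d₁) (fV (InjMorph.mor (kl r₁)) x) ≟ v) ×-dec any? (λ y → fV (g d₂) (fV (InjMorph.mor (kl r₂)) y) ≟ v))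
  overlapE? : ∀ e → Dec (OverlapE e)
  overlapE? e = impl3 (inImgE₁? e) (inImgE₂? e)
    (any? (λ x → fE (g d₁) (fE (InjMorph.mor (kl r₁)) x) ≟ e) ×-dec any? (λ y → fE (g d₂) (fE (InjMorph.mor (kl r₂)) y) ≟ e))
  combine : Dec (∀ v → OverlapV v) → Dec (∀ e → OverlapE e) → (IndependentV d₁ d₂ × IndependentE d₁ d₂) ⊎ Conflict d₁ d₂
  combine (yes iv) (yes ie) = inj₁ ((λ {v} gx gy → iv v (_ , gx) (_ , gy)) , (λ {e} gx gy → ie e (_ , gx) (_ , gy)))
  combine (no ¬iv) _ = let (v , ¬ov) = ¬∀⟶∃¬ _ OverlapV overlapV? ¬iv
                           (in₁ , in₂ , ¬pres) = witness3 (inImgV₁? v) (inImgV₂? v) ¬ov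
                       in inj₂ (inj₁ (v , in₁ , in₂ , ¬pres))
  combine (yes _) (no ¬ie) = let (e , ¬ov) = ¬∀⟶∃¬ _ OverlapE overlapE? ¬ie
                                 (in₁ , in₂ , ¬pres) = witness3 (inImgE₁? e) (inImgE₂? e) ¬ov
                             in inj₂ (inj₂ (e , in₁ , in₂ , ¬pres))

-- The result M of applying r₁ and then r₂ to G is described
-- by three parts: G (jG), R₁ (jF) and R₂ (jS).  For independent steps the
-- identifications made are given by a key that is symmetric in the two rules, so
-- applying the rules in the other order gives an isomorphic graph.
data J3 : Set where
  jG jF jS : J3

swapK : ∀ {X Y Z : Set} → X ⊎ (Y ⊎ Z) → X ⊎ (Z ⊎ Y)
swapK (inj₁ x) = inj₁ x
swapK (inj₂ (inj₁ y)) = inj₂ (inj₂ y)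
swapK (inj₂ (inj₂ z)) = inj₂ (inj₁ z)

module SequentialSort {L1 K1 R1 L2 K2 R2 IG IH1 IH2 IM : Set}
  {kl1 : K1 → L1} {kr1 : K1 → R1} {kl2 : K2 → L2} {kr2 : K2 → R2}
  (a1 : SortView L1 K1 R1 kl1 kr1 IG IH1) (a2 : SortView L2 K2 R2 kl2 kr2 IG IH2) (b2 : SortView L2 K2 R2 kl2 kr2 IH1 IM)
  (match : ∀ y → SortView.tr a1 (SortView.gm a2 y) ≡ just (SortView.gm b2 y))
  (indep : ∀ {v x y} → SortView.gm a1 x ≡ v → SortView.gm a2 y ≡ v → (∃ λ k → SortView.gm a1 (kl1 k) ≡ v) × (∃ λ k → SortView.gm a2 (kl2 k) ≡ v)) where
  module a1 = SortView a1
  module a2 = SortView a2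
  module b2 = SortView b2

  Key = IG ⊎ (R1 ⊎ R2)

  Item : J3 → Set
  Item jG = IG
  Item jF = R1
  Item jS = R2

  p : (j : J3) → Item j → Maybe IM
  p jG v = a1.tr v >>= b2.tr
  p jF a = b2.tr (a1.hm a)
  p jS b = just (b2.hm b)

  -- the key of an item: the item of G ⊎ R₁ ⊎ R₂ it is identified with, where
  -- images of K-items are represented by the matched item of G
  mG2 : ∀ v → Dec (∃ λ x → ¬ (∃ λ k → kl2 k ≡ x) × a2.gm x ≡ v) → Maybe Key
  mG2 v (yes _) = nothing
  mG2 v (no _) = just (inj₁ v)
  mG : ∀ v → Dec (∃ λ x → ¬ (∃ λ k → kl1 k ≡ x) × a1.gm x ≡ v) → Maybe Key
  mG v (yes _) = nothing
  mG v (no _) = mG2 v (a2.del? v)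
  mF : ∀ a → Dec (∃ λ k → kr1 k ≡ a) → Maybe Key
  mF a (yes (k , _)) = just (inj₁ (a1.gm (kl1 k)))
  mF a (no _) = just (inj₂ (inj₁ a))
  mS : ∀ b → Dec (∃ λ k → kr2 k ≡ b) → Maybe Key
  mS b (yes (k , _)) = just (inj₁ (a2.gm (kl2 k)))
  mS b (no _) = just (inj₂ (inj₂ b))

  m : (j : J3) → Item j → Maybe Key
  m jG v = mG v (a1.del? v)
  m jF a = mF a (a1.kr? a)
  m jS b = mS b (a2.kr? b)

  ψ : Key → Maybe IM
  ψ (inj₁ v) = p jG v
  ψ (inj₂ (inj₁ a)) = p jF a
  ψ (inj₂ (inj₂ b)) = p jS b

  Del1 Del2 : IG → Set
  Del1 v = ∃ λ x → ¬ (∃ λ k → kl1 k ≡ x) × a1.gm x ≡ v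
  Del2 v = ∃ λ x → ¬ (∃ λ k → kl2 k ≡ x) × a2.gm x ≡ v

  Valid : Key → Set
  Valid (inj₁ v) = ¬ Del1 v × ¬ Del2 v
  Valid (inj₂ (inj₁ a)) = ¬ (∃ λ k → kr1 k ≡ a)
  Valid (inj₂ (inj₂ b)) = ¬ (∃ λ k → kr2 k ≡ b)

  delB : ∀ {y} → ¬ (∃ λ k → kl2 k ≡ y) → ∀ x → a1.tr (a2.gm y) ≡ just x → b2.tr x ≡ nothing
  delB {y} ny x e = b2.tr-del x (y , ny , just-injective (trans (sym (match y)) e))

  factorG : ∀ v → p jG v ≡ (m jG v >>= ψ)
  factorG v with a1.del? v
  ... | yes d1 = cong (_>>= b2.tr) (a1.tr-del v d1)
  ... | no n1 with a2.del? v
  ...   | no n2 = refl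
  ...   | yes (y , ny , ey) with a1.tr v in et
  ...     | nothing = refl
  ...     | just x = delB ny x (trans (cong a1.tr ey) et)

  factorF : ∀ a → p jF a ≡ (m jF a >>= ψ)
  factorF a with a1.kr? a
  ... | no _ = refl
  ... | yes (k , refl) = sym (cong (_>>= b2.tr) (a1.com k))

  factorS : ∀ b → p jS b ≡ (m jS b >>= ψ)
  factorS b with a2.kr? b
  ... | no _ = refl
  ... | yes (k , refl) = sym (trans (cong (_>>= b2.tr) (match (kl2 k))) (b2.com k))

  factor : ∀ j a → p j a ≡ (m j a >>= ψ)
  factor jG = factorG
  factor jF = factorF
  factor jS = factorS

  keep1 : ∀ k → ¬ Del1 (a1.gm (kl1 k))
  keep1 k (x , nx , ex) = nx (k , sym (a1.gm-inj ex))
  keep2 : ∀ k → ¬ Del2 (a2.gm (kl2 k))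
  keep2 k (x , nx , ex) = nx (k , sym (a2.gm-inj ex))
  keep12 : ∀ k → ¬ Del2 (a1.gm (kl1 k))
  keep12 k (y , ny , ey) with indep refl ey
  ... | (_ , (k' , ek')) = ny (k' , a2.gm-inj (trans ek' (sym ey)))
  keep21 : ∀ k → ¬ Del1 (a2.gm (kl2 k))
  keep21 k (y , ny , ey) with indep ey refl
  ... | ((k' , ek') , _) = ny (k' , a1.gm-inj (trans ek' (sym ey)))

  keyValid : ∀ j a {c} → m j a ≡ just c → Valid c
  keyValid jG v e with a1.del? v
  keyValid jG v () | yes _
  ... | no n1 with a2.del? v
  keyValid jG v () | no n1 | yes _
  keyValid jG v refl | no n1 | no n2 = n1 , n2
  keyValid jF a e with a1.kr? a
  keyValid jF a refl | yes (k , _) = keep1 k , keep12 k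
  keyValid jF a refl | no n = n
  keyValid jS b e with a2.kr? b
  keyValid jS b refl | yes (k , _) = keep21 k , keep2 k
  keyValid jS b refl | no n = n

  validDefined : ∀ c → Valid c → ∃ λ x → ψ c ≡ just x
  validDefined (inj₁ v) (n1 , n2) with a1.tr v in et
  ... | nothing = ⊥-elim (n1 (a1.tr-keep v et))
  ... | just x with b2.tr x in ex
  ...   | just y = y , refl
  ...   | nothing = ⊥-elim (let (y , ny , ey) = b2.tr-keep x ex
                             in n2 (y , ny , a1.tr-inj (trans (match y) (cong just ey)) et))
  validDefined (inj₂ (inj₁ a)) n with b2.tr (a1.hm a) in ex
  ... | just y = y , refl
  ... | nothing = ⊥-elim (let (y , ny , ey) = b2.tr-keep _ ex
                           in a1.disj a (a2.gm y) n (trans (match y) (cong just ey)))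
  validDefined (inj₂ (inj₂ b)) n = b2.hm b , refl

  ψ-apartGF : ∀ v a {x} → ¬ (∃ λ k → kr1 k ≡ a) → ψ (inj₁ v) ≡ just x → ψ (inj₂ (inj₁ a)) ≡ just x → ⊥
  ψ-apartGF v a n e e' with bind-inv (a1.tr v) b2.tr e
  ... | (x1 , e1 , t1) = a1.disj a v n (trans e1 (cong just (b2.tr-inj t1 e')))
  ψ-apartGS : ∀ v b {x} → ¬ (∃ λ k → kr2 k ≡ b) → ψ (inj₁ v) ≡ just x → ψ (inj₂ (inj₂ b)) ≡ just x → ⊥
  ψ-apartGS v b n e e' with bind-inv (a1.tr v) b2.tr e
  ... | (x1 , e1 , t1) = b2.disj b x1 n (trans t1 (sym e'))
  ψ-apartFS : ∀ a b {x} → ¬ (∃ λ k → kr2 k ≡ b) → ψ (inj₂ (inj₁ a)) ≡ just x → ψ (inj₂ (inj₂ b)) ≡ just x → ⊥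
  ψ-apartFS a b n e e' = b2.disj b (a1.hm a) n (trans e (sym e'))

  ψ-injective : ∀ c c' {x} → Valid c → Valid c' → ψ c ≡ just x → ψ c' ≡ just x → c ≡ c'
  ψ-injective (inj₁ v) (inj₁ w) _ _ e e' with bind-inv (a1.tr v) b2.tr e | bind-inv (a1.tr w) b2.tr e'
  ... | (x1 , e1 , t1) | (x2 , e2 , t2) = cong inj₁ (a1.tr-inj e1 (trans e2 (cong just (b2.tr-inj t2 t1))))
  ψ-injective (inj₁ v) (inj₂ (inj₁ a)) _ n e e' = ⊥-elim (ψ-apartGF v a n e e')
  ψ-injective (inj₁ v) (inj₂ (inj₂ b)) {x} _ n e e' = ⊥-elim (ψ-apartGS v b {x} n e e')
  ψ-injective (inj₂ (inj₁ a)) (inj₁ v) n _ e e' = ⊥-elim (ψ-apartGF v a n e' e)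
  ψ-injective (inj₂ (inj₂ b)) (inj₁ v) {x} n _ e e' = ⊥-elim (ψ-apartGS v b {x} n e' e)
  ψ-injective (inj₂ (inj₁ a)) (inj₂ (inj₁ a')) _ _ e e' = cong (λ z → inj₂ (inj₁ z)) (a1.hm-inj (b2.tr-inj e e'))
  ψ-injective (inj₂ (inj₁ a)) (inj₂ (inj₂ b)) {x} _ n e e' = ⊥-elim (ψ-apartFS a b {x} n e e')
  ψ-injective (inj₂ (inj₂ b)) (inj₂ (inj₁ a)) {x} n _ e e' = ⊥-elim (ψ-apartFS a b {x} n e' e)
  ψ-injective (inj₂ (inj₂ b)) (inj₂ (inj₂ b')) _ _ e e' = cong (λ z → inj₂ (inj₂ z)) (b2.hm-inj (just-injective (trans e (sym e'))))

  sound : ∀ j a k b {x} → p j a ≡ just x → p k b ≡ just x → ∃ λ c → m j a ≡ just c × m k b ≡ just c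
  sound j a k b e e' with bind-inv (m j a) ψ (trans (sym (factor j a)) e) | bind-inv (m k b) ψ (trans (sym (factor k b)) e')
  ... | (c , mc , ψc) | (c' , mc' , ψc') with ψ-injective c c' (keyValid j a mc) (keyValid k b mc') ψc ψc'
  ... | refl = c , mc , mc'

  complete : ∀ j a k b {c} → m j a ≡ just c → m k b ≡ just c → ∃ λ x → p j a ≡ just x × p k b ≡ just x
  complete j a k b {c} mc mc' =
    let (x , ψx) = validDefined c (keyValid j a mc)
    in x , trans (factor j a) (trans (cong (_>>= ψ) mc) ψx) , trans (factor k b) (trans (cong (_>>= ψ) mc') ψx)

π3 : J3 → J3
π3 jG = jG
π3 jF = jS
π3 jS = jF

swapInv : ∀ {X Y Z : Set} (z : Maybe (X ⊎ (Y ⊎ Z))) {c} → Maybe.map swapK z ≡ just c → z ≡ just (swapK c)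
swapInv (just (inj₁ x)) refl = refl
swapInv (just (inj₂ (inj₁ y))) refl = refl
swapInv (just (inj₂ (inj₂ z))) refl = refl

-- The keys computed for r₁;r₂ and for r₂;r₁ agree up to the exchange of
-- right-hand sides, so both three-part descriptions make the same identifications.
module SwapSequential {L1 K1 R1 L2 K2 R2 IG IH1 IH2 IM IM' : Set}
  {kl1 : K1 → L1} {kr1 : K1 → R1} {kl2 : K2 → L2} {kr2 : K2 → R2}
  (a1 : SortView L1 K1 R1 kl1 kr1 IG IH1) (a2 : SortView L2 K2 R2 kl2 kr2 IG IH2)
  (b2 : SortView L2 K2 R2 kl2 kr2 IH1 IM) (b1 : SortView L1 K1 R1 kl1 kr1 IH2 IM')
  (match12 : ∀ y → SortView.tr a1 (SortView.gm a2 y) ≡ just (SortView.gm b2 y))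
  (indep12 : ∀ {v x y} → SortView.gm a1 x ≡ v → SortView.gm a2 y ≡ v → (∃ λ k → SortView.gm a1 (kl1 k) ≡ v) × (∃ λ k → SortView.gm a2 (kl2 k) ≡ v))
  (match21 : ∀ y → SortView.tr a2 (SortView.gm a1 y) ≡ just (SortView.gm b1 y))
  (indep21 : ∀ {v x y} → SortView.gm a2 x ≡ v → SortView.gm a1 y ≡ v → (∃ λ k → SortView.gm a2 (kl2 k) ≡ v) × (∃ λ k → SortView.gm a1 (kl1 k) ≡ v))
  (It : J3 → Set) (cG : It jG → IG) (cF : It jF → R1) (cS : It jS → R2) where
  module X = SequentialSort a1 a2 b2 match12 indep12
  module Y = SequentialSort a2 a1 b1 match21 indep21

  cvX : (j : J3) → It j → X.Item j
  cvX jG = cG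
  cvX jF = cF
  cvX jS = cS
  cvY : (j : J3) → It j → Y.Item (π3 j)
  cvY jG = cG
  cvY jF = cF
  cvY jS = cS

  pX : (j : J3) → It j → Maybe IM
  pX j a = X.p j (cvX j a)
  pY : (j : J3) → It j → Maybe IM'
  pY j a = Y.p (π3 j) (cvY j a)

  swG : ∀ v → Y.m jG v ≡ Maybe.map swapK (X.m jG v)
  swG v with SortView.del? a1 v in e1 | SortView.del? a2 v in e2
  ... | yes _ | yes _ = refl
  ... | yes _ | no _ rewrite e1 = refl
  ... | no _ | yes _ rewrite e2 = refl
  ... | no _ | no _ rewrite e1 | e2 = refl
  swF : ∀ a → Y.m jS a ≡ Maybe.map swapK (X.m jF a)
  swF a with SortView.kr? a1 a
  ... | yes _ = refl
  ... | no _ = refl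
  swS : ∀ a → Y.m jF a ≡ Maybe.map swapK (X.m jS a)
  swS a with SortView.kr? a2 a
  ... | yes _ = refl
  ... | no _ = refl

  sw : ∀ j a → Y.m (π3 j) (cvY j a) ≡ Maybe.map swapK (X.m j (cvX j a))
  sw jG a = swG (cG a)
  sw jF a = swF (cF a)
  sw jS a = swS (cS a)

  c12 : ∀ j a k b {x} → pX j a ≡ just x → pX k b ≡ just x → ∃ λ y → pY j a ≡ just y × pY k b ≡ just y
  c12 j a k b e e' =
    let (c , mc , mc') = X.sound j (cvX j a) k (cvX k b) e e'
    in Y.complete (π3 j) (cvY j a) (π3 k) (cvY k b) (trans (sw j a) (cong (Maybe.map swapK) mc)) (trans (sw k b) (cong (Maybe.map swapK) mc'))

  c21 : ∀ j a k b {x} → pY j a ≡ just x → pY k b ≡ just x → ∃ λ y → pX j a ≡ just y × pX k b ≡ just y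
  c21 j a k b e e' =
    let (c , mc , mc') = Y.sound (π3 j) (cvY j a) (π3 k) (cvY k b) e e'
    in X.complete j (cvX j a) k (cvX k b) (swapInv (X.m j (cvX j a)) (trans (sym (sw j a)) mc))
                                          (swapInv (X.m k (cvX k b)) (trans (sym (sw k b)) mc'))

ThreeParts : ∀ {A : Alphabet} → Graph A → Graph A → Graph A → J3 → Graph A
ThreeParts G Ra Rb jG = G
ThreeParts G Ra Rb jF = Ra
ThreeParts G Ra Rb jS = Rb

-- For independent d₁ and d₂, the match of d₂ tracked through d₁ is a match for r₂
-- on H₁ satisfying the dangling condition; apply it and describe the result by the
-- three parts G, R₁, R₂.
module SecondAfterFirst {A : Alphabet} {G H1 H2 : Graph A} (r1 r2 : Rule A) (d1 : DDer r1 G H1) (d2 : DDer r2 G H2)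
  (indepV : IndependentV d1 d2) (indepE : IndependentE d1 d2) where
  g1 = g d1
  g2 = g d2
  kL1 = InjMorph.mor (kl r1)
  kL2 = InjMorph.mor (kl r2)
  kR1 = InjMorph.mor (kr r1)

  defV : ∀ y → ∃ λ w → trV d1 (fV g2 y) ≡ just w
  defV y = defined _ λ e →
    let (x , nx , ex) = trV-keep d1 _ e
        ((k , ek) , _) = indepV ex refl
    in nx (k , g-injV d1 (trans ek (sym ex)))
  defE : ∀ y → ∃ λ w → trE d1 (fE g2 y) ≡ just w
  defE y = defined _ λ e →
    let (x , nx , ex) = trE-keep d1 _ e
        ((k , ek) , _) = indepE ex refl
    in nx (k , g-injE d1 (trans ek (sym ex)))

  mV : Node (L r2) → Node H1
  mV y = proj₁ (defV y)
  mE : Edge (L r2) → Edge H1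
  mE y = proj₁ (defE y)
  mVeq : ∀ y → trV d1 (fV g2 y) ≡ just (mV y)
  mVeq y = proj₂ (defV y)
  mEeq : ∀ y → trE d1 (fE g2 y) ≡ just (mE y)
  mEeq y = proj₂ (defE y)

  m2 : Morph (L r2) H1
  m2 = record
    { fV = mV ; fE = mE
    ; pres-s = λ x → just-injective (trans (sym (mVeq _)) (trans (cong (trV d1) (pres-s g2 x)) (trE-s d1 (mEeq x))))
    ; pres-t = λ x → just-injective (trans (sym (mVeq _)) (trans (cong (trV d1) (pres-t g2 x)) (trE-t d1 (mEeq x))))
    ; pres-lV = λ x → trans (trV-lab d1 (mVeq x)) (pres-lV g2 x)
    ; pres-lE = λ x → trans (trE-lab d1 (mEeq x)) (pres-lE g2 x) }

  m2injV : Injective _≡_ _≡_ mV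
  m2injV p = g-injV d2 (trV-inj d1 (mVeq _) (trans (mVeq _) (cong just (sym p))))
  m2injE : Injective _≡_ _≡_ mE
  m2injE p = g-injE d2 (trE-inj d1 (mEeq _) (trans (mEeq _) (cong just (sym p))))

  dangEnd : (sel : ∀ {Z : Graph A} → Edge Z → Node Z)
            (psel : ∀ {Z W : Graph A} (f : Morph Z W) c → fV f (sel {Z} c) ≡ sel {W} (fE f c))
            (dsel : ∀ c → ¬ InImgE g2 c → ¬ DelV d2 (sel {G} c))
            (trsel : ∀ {e f} → trE d1 e ≡ just f → trV d1 (sel {G} e) ≡ just (sel {H1} f)) →
            ∀ z → ¬ InImgE m2 z → ¬ (∃ λ x → ¬ InImgV kL2 x × mV x ≡ sel {H1} z)
  dangEnd sel psel dsel trsel z nz (y , ny , ey) with coverE d1 z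
  ... | inj₁ (c , ec) =
        dsel c (λ { (x , ex) → nz (x , just-injective (trans (sym (mEeq x)) (trans (cong (trE d1) ex) ec))) })
             (y , ny , trV-inj d1 (trans (mVeq y) (cong just ey)) (trsel ec))
  ... | inj₂ (a , na , ea) with any? (λ k → fV kR1 k ≟ sel {R r1} a)
  ...   | no n = disjV d1 (sel a) (fV g2 y) n
             (trans (mVeq y) (cong just (trans ey (trans (cong sel (sym ea)) (sym (psel (h d1) a))))))
  ...   | yes (k , ek) =
          let e1 : trV d1 (fV g1 (fV kL1 k)) ≡ just (mV y)
              e1 = trans (comV d1 k) (trans (cong (λ z → just (fV (h d1) z)) ek)
                     (cong just (trans (psel (h d1) a) (trans (cong sel ea) (sym ey)))) ) 
              eq : fV g1 (fV kL1 k) ≡ fV g2 y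
              eq = trV-inj d1 e1 (mVeq y)
              (_ , (k' , ek')) = indepV eq refl
          in ny (k' , g-injV d2 ek')

  dang : DanglingCondition r2 m2
  dang z nz = dangEnd (λ {Z} → s Z) (λ f → pres-s f) (λ c n → proj₁ (dangling d2 c n)) (trE-s d1) z nz
            , dangEnd (λ {Z} → t Z) (λ f → pres-t f) (λ c n → proj₂ (dangling d2 c n)) (trE-t d1) z nz

  opaque
    B : Σ (Graph A) λ H → Σ (DDer r2 H1 H) λ d → SameMorph (g d) m2
    B = derivationExists r2 H1 m2 m2injV m2injE dang
  M : Graph A
  M = proj₁ B
  e2 : DDer r2 H1 M
  e2 = proj₁ (proj₂ B)
  sV : ∀ x → fV (g e2) x ≡ mV x
  sV = proj₁ (proj₂ (proj₂ B))
  sE : ∀ x → fE (g e2) x ≡ mE x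
  sE = proj₂ (proj₂ (proj₂ B))

  module IV = SequentialSort (nodeView d1) (nodeView d2) (nodeView e2) (λ y → trans (mVeq y) (cong just (sym (sV y)))) indepV
  module IE = SequentialSort (edgeView d1) (edgeView d2) (edgeView e2) (λ y → trans (mEeq y) (cong just (sym (sE y)))) indepE

  SS = ThreeParts G (R r1) (R r2)

  desc : Description J3 SS M
  desc = record { pV = pv ; pE = pe ; ps = λ {j} {a} → ps' {j} {a} ; pt = λ {j} {a} → pt' {j} {a}
                ; plV = λ {j} {a} → plv {j} {a} ; plE = λ {j} {a} → ple {j} {a} }
    where
    pv : (j : J3) → Node (SS j) → Maybe (Node M)
    pv jG = IV.p jG
    pv jF = IV.p jF
    pv jS = IV.p jS
    pe : (j : J3) → Edge (SS j) → Maybe (Edge M)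
    pe jG = IE.p jG
    pe jF = IE.p jF
    pe jS = IE.p jS
    ps' : ∀ {j a f} → pe j a ≡ just f → pv j (s (SS j) a) ≡ just (s M f)
    ps' {jG} {a} eq with bind-inv (trE d1 a) (trE e2) eq
    ... | (f1 , e1 , t1) = trans (cong (_>>= trV e2) (trE-s d1 e1)) (trE-s e2 t1)
    ps' {jF} {a} eq = trans (cong (trV e2) (pres-s (h d1) a)) (trE-s e2 eq)
    ps' {jS} {a} eq = trans (cong just (pres-s (h e2) a)) (cong (λ z → just (s M z)) (just-injective eq))
    pt' : ∀ {j a f} → pe j a ≡ just f → pv j (t (SS j) a) ≡ just (t M f)
    pt' {jG} {a} eq with bind-inv (trE d1 a) (trE e2) eq
    ... | (f1 , e1 , t1) = trans (cong (_>>= trV e2) (trE-t d1 e1)) (trE-t e2 t1)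
    pt' {jF} {a} eq = trans (cong (trV e2) (pres-t (h d1) a)) (trE-t e2 eq)
    pt' {jS} {a} eq = trans (cong just (pres-t (h e2) a)) (cong (λ z → just (t M z)) (just-injective eq))
    plv : ∀ {j a x} → pv j a ≡ just x → lV M x ≡ lV (SS j) a
    plv {jG} {a} eq with bind-inv (trV d1 a) (trV e2) eq
    ... | (f1 , e1 , t1) = trans (trV-lab e2 t1) (trV-lab d1 e1)
    plv {jF} {a} eq = trans (trV-lab e2 eq) (pres-lV (h d1) a)
    plv {jS} {a} eq = trans (cong (lV M) (sym (just-injective eq))) (pres-lV (h e2) a)
    ple : ∀ {j a x} → pe j a ≡ just x → lE M x ≡ lE (SS j) a
    ple {jG} {a} eq with bind-inv (trE d1 a) (trE e2) eq
    ... | (f1 , e1 , t1) = trans (trE-lab e2 t1) (trE-lab d1 e1)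
    ple {jF} {a} eq = trans (trE-lab e2 eq) (pres-lE (h d1) a)
    ple {jS} {a} eq = trans (cong (lE M) (sym (just-injective eq))) (pres-lE (h e2) a)

  cover : Covers desc
  cover = cv , ce
    where
    cv : ∀ x → Σ J3 λ j → Σ (Node (SS j)) λ a → Description.pV desc j a ≡ just x
    cv x with coverV e2 x
    ... | inj₂ (b , _ , eb) = jS , b , cong just eb
    ... | inj₁ (w , ew) with coverV d1 w
    ...   | inj₁ (v , ev) = jG , v , trans (cong (_>>= trV e2) ev) ew
    ...   | inj₂ (a , _ , ea) = jF , a , trans (cong (trV e2) ea) ew
    ce : ∀ x → Σ J3 λ j → Σ (Edge (SS j)) λ a → Description.pE desc j a ≡ just x
    ce x with coverE e2 x
    ... | inj₂ (b , _ , eb) = jS , b , cong just eb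
    ... | inj₁ (w , ew) with coverE d1 w
    ...   | inj₁ (v , ev) = jG , v , trans (cong (_>>= trE e2) ev) ew
    ...   | inj₂ (a , _ , ea) = jF , a , trans (cong (trE e2) ea) ew

swapDescription : ∀ {A : Alphabet} {G Ra Rb X : Graph A} → Description J3 (ThreeParts G Ra Rb) X → Description J3 (ThreeParts G Rb Ra) X
swapDescription {A} {G} {Ra} {Rb} {X} d = record { pV = pv ; pE = pe ; ps = λ {j} {a} → ps' {j} {a} ; pt = λ {j} {a} → pt' {j} {a}
                ; plV = λ {j} {a} → plv {j} {a} ; plE = λ {j} {a} → ple {j} {a} }
  where
  SS = ThreeParts G Rb Ra
  pv : (j : J3) → Node (SS j) → Maybe (Node X)
  pv jG = pV d jG
  pv jF = pV d jS
  pv jS = pV d jF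
  pe : (j : J3) → Edge (SS j) → Maybe (Edge X)
  pe jG = pE d jG
  pe jF = pE d jS
  pe jS = pE d jF
  ps' : ∀ {j a f} → pe j a ≡ just f → pv j (s (SS j) a) ≡ just (s X f)
  ps' {jG} = ps d {jG}
  ps' {jF} = ps d {jS}
  ps' {jS} = ps d {jF}
  pt' : ∀ {j a f} → pe j a ≡ just f → pv j (t (SS j) a) ≡ just (t X f)
  pt' {jG} = pt d {jG}
  pt' {jF} = pt d {jS}
  pt' {jS} = pt d {jF}
  plv : ∀ {j a x} → pv j a ≡ just x → lV X x ≡ lV (SS j) a
  plv {jG} = plV d {jG}
  plv {jF} = plV d {jS}
  plv {jS} = plV d {jF}
  ple : ∀ {j a x} → pe j a ≡ just x → lE X x ≡ lE (SS j) a
  ple {jG} = plE d {jG}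
  ple {jF} = plE d {jS}
  ple {jS} = plE d {jF}

swapDescriptionCovers : ∀ {A : Alphabet} {G Ra Rb X : Graph A} (d : Description J3 (ThreeParts G Ra Rb) X) → Covers d → Covers (swapDescription d)
swapDescriptionCovers d (cv , ce) = (λ x → go (cv x)) , (λ x → goE (ce x))
  where
  go : ∀ {x} → (Σ J3 λ j → Σ _ λ a → pV d j a ≡ just x) → Σ J3 λ j → Σ _ λ a → pV (swapDescription d) j a ≡ just x
  go (jG , a , e) = jG , a , e
  go (jF , a , e) = jS , a , e
  go (jS , a , e) = jF , a , e
  goE : ∀ {x} → (Σ J3 λ j → Σ _ λ a → pE d j a ≡ just x) → Σ J3 λ j → Σ _ λ a → pE (swapDescription d) j a ≡ just x
  goE (jG , a , e) = jG , a , e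
  goE (jF , a , e) = jS , a , e
  goE (jS , a , e) = jF , a , e

module ParallelIndependence {A : Alphabet} (T : GTS A) {G H1 H2 : Graph A} (i1 i2 : Fin (nR T))
  (d1 : DDer (rule T i1) G H1) (d2 : DDer (rule T i2) G H2)
  (indepV : IndependentV d1 d2) (indepE : IndependentE d1 d2) where
  r1 = rule T i1
  r2 = rule T i2
  module H12 = SecondAfterFirst r1 r2 d1 d2 indepV indepE
  module H21 = SecondAfterFirst r2 r1 d2 d1 (independentV-sym d1 d2 indepV) (independentE-sym d1 d2 indepE)

  desc1 = H12.desc
  desc2 = swapDescription H21.desc

  module SCV = SwapSequential (nodeView d1) (nodeView d2) (nodeView H12.e2) (nodeView H21.e2)
     (λ y → trans (H12.mVeq y) (cong just (sym (H12.sV y)))) indepV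
     (λ y → trans (H21.mVeq y) (cong just (sym (H21.sV y)))) (independentV-sym d1 d2 indepV)
     (λ j → Node (ThreeParts G (R r1) (R r2) j)) (λ x → x) (λ x → x) (λ x → x)
  module SCE = SwapSequential (edgeView d1) (edgeView d2) (edgeView H12.e2) (edgeView H21.e2)
     (λ y → trans (H12.mEeq y) (cong just (sym (H12.sE y)))) indepE
     (λ y → trans (H21.mEeq y) (cong just (sym (H21.sE y)))) (independentE-sym d1 d2 indepE)
     (λ j → Edge (ThreeParts G (R r1) (R r2) j)) (λ x → x) (λ x → x) (λ x → x)

  -- the nine combinations of parts, split so that the descriptions compute
  c12V : ∀ j a k b {x} → pV desc1 j a ≡ just x → pV desc1 k b ≡ just x → ∃ λ y → pV desc2 j a ≡ just y × pV desc2 k b ≡ just y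
  c12V jG a jG b = SCV.c12 jG a jG b
  c12V jG a jF b = SCV.c12 jG a jF b
  c12V jG a jS b = SCV.c12 jG a jS b
  c12V jF a jG b = SCV.c12 jF a jG b
  c12V jF a jF b = SCV.c12 jF a jF b
  c12V jF a jS b = SCV.c12 jF a jS b
  c12V jS a jG b = SCV.c12 jS a jG b
  c12V jS a jF b = SCV.c12 jS a jF b
  c12V jS a jS b = SCV.c12 jS a jS b
  c21V : ∀ j a k b {x} → pV desc2 j a ≡ just x → pV desc2 k b ≡ just x → ∃ λ y → pV desc1 j a ≡ just y × pV desc1 k b ≡ just y
  c21V jG a jG b = SCV.c21 jG a jG b
  c21V jG a jF b = SCV.c21 jG a jF b
  c21V jG a jS b = SCV.c21 jG a jS b
  c21V jF a jG b = SCV.c21 jF a jG b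
  c21V jF a jF b = SCV.c21 jF a jF b
  c21V jF a jS b = SCV.c21 jF a jS b
  c21V jS a jG b = SCV.c21 jS a jG b
  c21V jS a jF b = SCV.c21 jS a jF b
  c21V jS a jS b = SCV.c21 jS a jS b
  c12E : ∀ j a k b {x} → pE desc1 j a ≡ just x → pE desc1 k b ≡ just x → ∃ λ y → pE desc2 j a ≡ just y × pE desc2 k b ≡ just y
  c12E jG a jG b = SCE.c12 jG a jG b
  c12E jG a jF b = SCE.c12 jG a jF b
  c12E jG a jS b = SCE.c12 jG a jS b
  c12E jF a jG b = SCE.c12 jF a jG b
  c12E jF a jF b = SCE.c12 jF a jF b
  c12E jF a jS b = SCE.c12 jF a jS b
  c12E jS a jG b = SCE.c12 jS a jG b
  c12E jS a jF b = SCE.c12 jS a jF b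
  c12E jS a jS b = SCE.c12 jS a jS b
  c21E : ∀ j a k b {x} → pE desc2 j a ≡ just x → pE desc2 k b ≡ just x → ∃ λ y → pE desc1 j a ≡ just y × pE desc1 k b ≡ just y
  c21E jG a jG b = SCE.c21 jG a jG b
  c21E jG a jF b = SCE.c21 jG a jF b
  c21E jG a jS b = SCE.c21 jG a jS b
  c21E jF a jG b = SCE.c21 jF a jG b
  c21E jF a jF b = SCE.c21 jF a jF b
  c21E jF a jS b = SCE.c21 jF a jS b
  c21E jS a jG b = SCE.c21 jS a jG b
  c21E jS a jF b = SCE.c21 jS a jF b
  c21E jS a jS b = SCE.c21 jS a jS b

  isoM : Iso H12.M H21.M
  isoM = descriptionIso desc1 H12.cover desc2 (swapDescriptionCovers H21.desc H21.cover)
           ((λ {j} {a} {k} {b} → c12V j a k b) , (λ {j} {a} {k} {b} → c12E j a k b))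
           ((λ {j} {a} {k} {b} → c21V j a k b) , (λ {j} {a} {k} {b} → c21E j a k b))

  result : ∃ λ M → (_⇒*_ T H1 M) × (_⇒*_ T H2 M)
  result = H12.M , step (i2 , H12.e2) (done (idIso H12.M)) , step (i1 , H21.e2) (done (symIso isoM))

module Subgraph {A : Alphabet} (G : Graph A) (PV : Node G → Set) (PE : Edge G → Set)
           (dV : ∀ v → Dec (PV v)) (dE : ∀ e → Dec (PE e))
           (cs : ∀ e → PE e → PV (s G e)) (ct : ∀ e → PE e → PV (t G e)) where
  EV = enum (nV G) PV dV
  EE = enum (nE G) PE dE

  S : Graph A
  S = record { nV = Enum.k EV ; nE = Enum.k EE
             ; s = λ i → Enum.idx EV (s G (Enum.emb EE i)) (cs _ (Enum.embP EE i))
             ; t = λ i → Enum.idx EV (t G (Enum.emb EE i)) (ct _ (Enum.embP EE i))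
             ; lV = λ i → lV G (Enum.emb EV i) ; lE = λ i → lE G (Enum.emb EE i) }

  ιm : Morph S G
  ιm = record { fV = Enum.emb EV ; fE = Enum.emb EE
              ; pres-s = λ i → Enum.emb-idx EV _ _ ; pres-t = λ i → Enum.emb-idx EV _ _
              ; pres-lV = λ _ → refl ; pres-lE = λ _ → refl }

  ι : InjMorph S G
  ι = record { mor = ιm ; injV = Enum.emb-inj EV ; injE = Enum.emb-inj EE }

  inV : ∀ v → PV v → InImgV ιm v
  inV v p = Enum.idx EV v p , Enum.emb-idx EV v p
  inE : ∀ e → PE e → InImgE ιm e
  inE e p = Enum.idx EE e p , Enum.emb-idx EE e p

-- A derivation from G' whose tracks
-- preserve all boundary nodes can be performed on G.
module Context {A : Alphabet} (T : GTS A) {G G' : Graph A} (ι : InjMorph G' G) where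
  ιm = InjMorph.mor ι

  Boundary : Node G' → Set
  Boundary u = ∃ λ c → ¬ InImgE ιm c × (s G c ≡ fV ιm u ⊎ t G c ≡ fV ιm u)

  -- Invariant relating a graph X' derived from G' and a graph X derived from G:
  -- X' embeds into X (em), τ' and τ track G' into X' and G into X, τ agrees with em on
  -- G', and X consists of em(X') and the injectively tracked context of G.
  record Embedded (X' X : Graph A) : Set where
    field
      τ' : Node G' → Maybe (Node X')
      τ : Node G → Maybe (Node X)
      τE : Edge G → Maybe (Edge X)
      em : InjMorph X' X
      τ-ι : ∀ u → τ (fV ιm u) ≡ (τ' u >>= λ x → just (fV (InjMorph.mor em) x))
      τ-outside : ∀ v → ¬ InImgV ιm v → ∃ λ x → τ v ≡ just x × ¬ InImgV (InjMorph.mor em) x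
      τ-injective : ∀ {v v' x} → τ v ≡ just x → τ v' ≡ just x → v ≡ v'
      τ-joint : ∀ x → InImgV (InjMorph.mor em) x ⊎ ∃ λ v → ¬ InImgV ιm v × τ v ≡ just x
      τ-label : ∀ {v x} → τ v ≡ just x → lV X x ≡ lV G v
      τE-outside : ∀ c → ¬ InImgE ιm c → ∃ λ y → τE c ≡ just y × ¬ InImgE (InjMorph.mor em) y
      τE-injective : ∀ {c c' y} → τE c ≡ just y → τE c' ≡ just y → c ≡ c'
      τE-joint : ∀ y → InImgE (InjMorph.mor em) y ⊎ ∃ λ c → ¬ InImgE ιm c × τE c ≡ just y
      τE-label : ∀ {c y} → τE c ≡ just y → lE X y ≡ lE G c
      τE-s : ∀ {c y} → τE c ≡ just y → τ (s G c) ≡ just (s X y)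
      τE-t : ∀ {c y} → τE c ≡ just y → τ (t G c) ≡ just (t X y)
  open Embedded public

  initialEmbedding : Embedded G' G
  initialEmbedding = record
    { τ' = just ; τ = just ; τE = just ; em = ι
    ; τ-ι = λ u → refl
    ; τ-outside = λ v nv → v , refl , nv
    ; τ-injective = λ e e' → just-injective (trans e (sym e'))
    ; τ-joint = λ x → n4 x (any? (λ u → fV ιm u ≟ x))
    ; τ-label = λ e → cong (lV G) (sym (just-injective e))
    ; τE-outside = λ v nv → v , refl , nv
    ; τE-injective = λ e e' → just-injective (trans e (sym e'))
    ; τE-joint = λ x → e4 x (any? (λ u → fE ιm u ≟ x))
    ; τE-label = λ e → cong (lE G) (sym (just-injective e))
    ; τE-s = λ e → cong (λ z → just (s G z)) (just-injective e)
    ; τE-t = λ e → cong (λ z → just (t G z)) (just-injective e) }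
    where
    n4 : ∀ x → Dec (InImgV ιm x) → InImgV ιm x ⊎ ∃ λ v → ¬ InImgV ιm v × just v ≡ just x
    n4 x (yes i) = inj₁ i
    n4 x (no n) = inj₂ (x , n , refl)
    e4 : ∀ x → Dec (InImgE ιm x) → InImgE ιm x ⊎ ∃ λ v → ¬ InImgE ιm v × just v ≡ just x
    e4 x (yes i) = inj₁ i
    e4 x (no n) = inj₂ (x , n , refl)

  module ExtendStep {r : Rule A} {X' X Y' : Graph A} (st : Embedded X' X) (d' : DDer r X' Y')
             (safe : ∀ u x → Boundary u → τ' st u ≡ just x → ∃ λ y → trV d' x ≡ just y) where
    e = InjMorph.mor (em st)
    kL = InjMorph.mor (kl r)
    gb : Morph (L r) X
    gb = e ∘M g d'
    gbInjV : Injective _≡_ _≡_ (fV gb)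
    gbInjV p = g-injV d' (InjMorph.injV (em st) p)
    gbInjE : Injective _≡_ _≡_ (fE gb)
    gbInjE p = g-injE d' (InjMorph.injE (em st) p)

    -- the match em ∘ g d' satisfies the dangling condition in X: an edge outside the
    -- image is in em(X') (use the dangling condition of d') or comes from the context,
    -- and then its endpoints in em(X') are tracked boundary nodes, which d' preserves
    dangEnd : (sel : ∀ {Z : Graph A} → Edge Z → Node Z)
              (psel : ∀ {Z W : Graph A} (f : Morph Z W) c → fV f (sel {Z} c) ≡ sel {W} (fE f c))
              (dsel : ∀ c → ¬ InImgE (g d') c → ¬ DelV d' (sel {X'} c))
              (bsel : ∀ c u → sel {G} c ≡ fV ιm u → (s G c ≡ fV ιm u ⊎ t G c ≡ fV ιm u))
              (Esel : ∀ {c y} → τE st c ≡ just y → τ st (sel {G} c) ≡ just (sel {X} y)) →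
              ∀ z → ¬ InImgE gb z → ¬ (∃ λ x → ¬ InImgV kL x × fV gb x ≡ sel {X} z)
    dangEnd sel psel dsel bsel Esel z nz (y , ny , gy) with τE-joint st z
    ... | inj₁ (z' , refl) =
          dsel z' (λ { (x , gx) → nz (x , cong (fE e) gx) })
               (y , ny , InjMorph.injV (em st) (trans gy (sym (psel e z'))))
    ... | inj₂ (c , nc , τc) with any? (λ u → fV ιm u ≟ sel {G} c)
    ...   | no n = let (x , τx , nx) = τ-outside st (sel {G} c) n
                   in nx (fV (g d') y , trans gy (just-injective (trans (sym (Esel τc)) τx)))
    ...   | yes (u , ιu) with τ' st u in eu
    ...     | nothing = just≢nothing (trans (sym (Esel τc)) (trans (cong (τ st) (sym ιu)) (trans (τ-ι st u) (cong (_>>= _) eu))))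
    ...     | just x' =
               let ex' : fV e x' ≡ sel {X} z
                   ex' = just-injective (trans (sym (trans (τ-ι st u) (cong (_>>= _) eu))) (trans (cong (τ st) ιu) (Esel τc)))
                   x'≡ : fV (g d') y ≡ x'
                   x'≡ = InjMorph.injV (em st) (trans gy (sym ex'))
                   (w , tw) = safe u x' (c , nc , bsel c u (sym ιu)) eu
               in just≢nothing (trans (sym tw) (trV-del d' x' (y , ny , x'≡)))

    dang : DanglingCondition r gb
    dang z nz = dangEnd (λ {Z} → s Z) (λ f → pres-s f) (λ c n → proj₁ (dangling d' c n)) (λ c u eq → inj₁ eq) (τE-s st) z nz
              , dangEnd (λ {Z} → t Z) (λ f → pres-t f) (λ c n → proj₂ (dangling d' c n)) (λ c u eq → inj₂ eq) (τE-t st) z nz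

    opaque
      B : Σ (Graph A) λ H → Σ (DDer r X H) λ d → SameMorph (g d) gb
      B = derivationExists r X gb gbInjV gbInjE dang
    Y = proj₁ B
    d : DDer r X Y
    d = proj₁ (proj₂ B)

    gsV : ∀ x → fV (g d) x ≡ fV e (fV (g d') x)
    gsV = proj₁ (proj₂ (proj₂ B))
    gsE : ∀ x → fE (g d) x ≡ fE e (fE (g d') x)
    gsE = proj₂ (proj₂ (proj₂ B))
    module SC = CompareDerivations d' d (em st) gsV gsE
    RR = SC.result
    f = InjMorph.mor (proj₁ RR)
    trP : ∀ {v w} → trV d' v ≡ just w → trV d (fV e v) ≡ just (fV f w)
    trP = proj₁ (proj₂ RR)
    hP : ∀ x → fV f (fV (h d') x) ≡ fV (h d) x
    hP = proj₁ (proj₂ (proj₂ RR))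
    trPE : ∀ {v w} → trE d' v ≡ just w → trE d (fE e v) ≡ just (fE f w)
    trPE = proj₁ (proj₂ (proj₂ (proj₂ RR)))
    hPE : ∀ x → fE f (fE (h d') x) ≡ fE (h d) x
    hPE = proj₂ (proj₂ (proj₂ (proj₂ RR)))

    keyV : ∀ x' → trV d (fV e x') ≡ (trV d' x' >>= λ w → just (fV f w))
    keyV x' with trV d' x' in eq
    ... | just w = trP eq
    ... | nothing = trV-del d (fV e x') (SC.CV.delSB x' (trV-keep d' x' eq))

    n1 : ∀ u → (τ st (fV ιm u) >>= trV d) ≡ ((τ' st u >>= trV d') >>= λ x → just (fV f x))
    n1 u with τ' st u in eu
    ... | nothing = cong (_>>= trV d) (trans (τ-ι st u) (cong (_>>= _) eu))
    ... | just x' = trans (cong (_>>= trV d) (trans (τ-ι st u) (cong (_>>= _) eu))) (keyV x')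

    n2 : ∀ v → ¬ InImgV ιm v → ∃ λ x → (τ st v >>= trV d) ≡ just x × ¬ InImgV f x
    n2 v nv with τ-outside st v nv
    ... | (x , τx , nx) with trV d x in ex
    ...   | nothing = ⊥-elim (let (y , ny , gy) = trV-keep d x ex in nx (fV (g d') y , trans (sym (gsV y)) gy))
    ...   | just x2 = x2 , trans (cong (_>>= trV d) τx) ex , nimg
      where
      nimg : ¬ InImgV f x2
      nimg (w , fw) = go (coverV d' w)
       where
       go : (∃ λ v → trV d' v ≡ just w) ⊎ (∃ λ x → ¬ InImgV (InjMorph.mor (kr r)) x × fV (h d') x ≡ w) → ⊥
       go (inj₁ (x' , tx')) = nx (x' , trV-inj d (trans (trP tx') (cong just fw)) ex)
       go (inj₂ (a , na , ha)) = disjV d a x na (trans ex (cong just (sym (trans (sym (hP a)) (trans (cong (fV f) ha) fw)))))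

    n3 : ∀ {v v' y} → (τ st v >>= trV d) ≡ just y → (τ st v' >>= trV d) ≡ just y → v ≡ v'
    n3 {v} {v'} p q with bind-inv (τ st v) (trV d) p | bind-inv (τ st v') (trV d) q
    ... | (x , ex , tx) | (x'' , ex'' , tx'') with trV-inj d tx tx''
    ... | refl = τ-injective st ex ex''

    n4 : ∀ y → InImgV f y ⊎ ∃ λ v → ¬ InImgV ιm v × (τ st v >>= trV d) ≡ just y
    n4 y with coverV d y
    ... | inj₂ (a , na , ha) = inj₁ (fV (h d') a , trans (hP a) ha)
    ... | inj₁ (x , tx) with τ-joint st x
    ...   | inj₂ (v , nv , τv) = inj₂ (v , nv , trans (cong (_>>= trV d) τv) tx)
    ...   | inj₁ (x' , refl) = let (w , tw) = SC.CV.defA x' y tx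
                               in inj₁ (w , just-injective (trans (sym (trP tw)) tx))

    nl : ∀ {v x} → (τ st v >>= trV d) ≡ just x → lV Y x ≡ lV G v
    nl {v} p with bind-inv (τ st v) (trV d) p
    ... | (x , ex , tx) = trans (trV-lab d tx) (τ-label st ex)

    e2 : ∀ c → ¬ InImgE ιm c → ∃ λ y → (τE st c >>= trE d) ≡ just y × ¬ InImgE f y
    e2 c nc with τE-outside st c nc
    ... | (x , τx , nx) with trE d x in ex
    ...   | nothing = ⊥-elim (let (y , ny , gy) = trE-keep d x ex in nx (fE (g d') y , trans (sym (gsE y)) gy))
    ...   | just x2 = x2 , trans (cong (_>>= trE d) τx) ex , nimg
      where
      nimg : ¬ InImgE f x2
      nimg (w , fw) = go (coverE d' w)
       where
       go : (∃ λ v → trE d' v ≡ just w) ⊎ (∃ λ x → ¬ InImgE (InjMorph.mor (kr r)) x × fE (h d') x ≡ w) → ⊥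
       go (inj₁ (x' , tx')) = nx (x' , trE-inj d (trans (trPE tx') (cong just fw)) ex)
       go (inj₂ (a , na , ha)) = disjE d a x na (trans ex (cong just (sym (trans (sym (hPE a)) (trans (cong (fE f) ha) fw)))))

    e3 : ∀ {v v' y} → (τE st v >>= trE d) ≡ just y → (τE st v' >>= trE d) ≡ just y → v ≡ v'
    e3 {v} {v'} p q with bind-inv (τE st v) (trE d) p | bind-inv (τE st v') (trE d) q
    ... | (x , ex , tx) | (x'' , ex'' , tx'') with trE-inj d tx tx''
    ... | refl = τE-injective st ex ex''

    e4 : ∀ y → InImgE f y ⊎ ∃ λ v → ¬ InImgE ιm v × (τE st v >>= trE d) ≡ just y
    e4 y with coverE d y
    ... | inj₂ (a , na , ha) = inj₁ (fE (h d') a , trans (hPE a) ha)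
    ... | inj₁ (x , tx) with τE-joint st x
    ...   | inj₂ (v , nv , τv) = inj₂ (v , nv , trans (cong (_>>= trE d) τv) tx)
    ...   | inj₁ (x' , refl) = let (w , tw) = SC.CE.defA x' y tx
                               in inj₁ (w , just-injective (trans (sym (trPE tw)) tx))

    el : ∀ {v x} → (τE st v >>= trE d) ≡ just x → lE Y x ≡ lE G v
    el {v} p with bind-inv (τE st v) (trE d) p
    ... | (x , ex , tx) = trans (trE-lab d tx) (τE-label st ex)

    es : ∀ {c y} → (τE st c >>= trE d) ≡ just y → (τ st (s G c) >>= trV d) ≡ just (s Y y)
    es {c} p with bind-inv (τE st c) (trE d) p
    ... | (x , ex , tx) = trans (cong (_>>= trV d) (τE-s st ex)) (trE-s d tx)
    et : ∀ {c y} → (τE st c >>= trE d) ≡ just y → (τ st (t G c) >>= trV d) ≡ just (t Y y)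
    et {c} p with bind-inv (τE st c) (trE d) p
    ... | (x , ex , tx) = trans (cong (_>>= trV d) (τE-t st ex)) (trE-t d tx)

    st' : Embedded Y' Y
    st' = record
      { τ' = λ u → τ' st u >>= trV d' ; τ = λ v → τ st v >>= trV d ; τE = λ c → τE st c >>= trE d
      ; em = proj₁ RR
      ; τ-ι = n1 ; τ-outside = n2 ; τ-injective = n3 ; τ-joint = n4 ; τ-label = nl
      ; τE-outside = e2 ; τE-injective = e3 ; τE-joint = e4 ; τE-label = el ; τE-s = es ; τE-t = et }

  record Extension {r : Rule A} {X' X Y' : Graph A} (st : Embedded X' X) (d' : DDer r X' Y') : Set where
    field
      Y : Graph A
      d : DDer r X Y
      gsV : ∀ x → fV (g d) x ≡ fV (InjMorph.mor (em st)) (fV (g d') x)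
      gsE : ∀ x → fE (g d) x ≡ fE (InjMorph.mor (em st)) (fE (g d') x)
      st' : Embedded Y' Y
      τeq : ∀ u → τ' st' u ≡ (τ' st u >>= trV d')

  opaque
    extendStep : ∀ {r : Rule A} {X' X Y' : Graph A} (st : Embedded X' X) (d' : DDer r X' Y') →
          (∀ u x → Boundary u → τ' st u ≡ just x → ∃ λ y → trV d' x ≡ just y) → Extension st d'
    extendStep st d' safe = record { Y = E.Y ; d = E.d ; gsV = E.gsV ; gsE = E.gsE ; st' = E.st' ; τeq = λ u → refl }
      where module E = ExtendStep st d' safe

  embeddingAlongIso : ∀ {X' X M'} → Embedded X' X → Iso X' M' → Embedded M' X
  embeddingAlongIso {X'} {X} {M'} st φ = record
    { τ' = λ u → τ' st u >>= λ x → just (fV (Iso.to φ) x)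
    ; τ = τ st ; τE = τE st
    ; em = em'
    ; τ-ι = n1 ; τ-outside = n2 ; τ-injective = τ-injective st ; τ-joint = n4 ; τ-label = τ-label st
    ; τE-outside = e2 ; τE-injective = τE-injective st ; τE-joint = e4 ; τE-label = τE-label st ; τE-s = τE-s st ; τE-t = τE-t st }
    where
    e = InjMorph.mor (em st)
    em' : InjMorph M' X
    em' = record { mor = e ∘M Iso.from φ
                 ; injV = λ p → trans (sym (Iso.invV₂ φ _)) (trans (cong (fV (Iso.to φ)) (InjMorph.injV (em st) p)) (Iso.invV₂ φ _))
                 ; injE = λ p → trans (sym (Iso.invE₂ φ _)) (trans (cong (fE (Iso.to φ)) (InjMorph.injE (em st) p)) (Iso.invE₂ φ _)) }
    n1 : ∀ u → τ st (fV ιm u) ≡ ((τ' st u >>= λ x → just (fV (Iso.to φ) x)) >>= λ x → just (fV (InjMorph.mor em') x))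
    n1 u with τ' st u in eu
    ... | nothing = trans (τ-ι st u) (cong (_>>= _) eu)
    ... | just x = trans (τ-ι st u) (trans (cong (_>>= _) eu) (cong (λ z → just (fV e z)) (sym (Iso.invV₁ φ x))))
    n2 : ∀ v → ¬ InImgV ιm v → ∃ λ x → τ st v ≡ just x × ¬ InImgV (InjMorph.mor em') x
    n2 v nv = let (x , ex , nx) = τ-outside st v nv in x , ex , λ { (a , p) → nx (fV (Iso.from φ) a , p) }
    n4 : ∀ x → InImgV (InjMorph.mor em') x ⊎ ∃ λ v → ¬ InImgV ιm v × τ st v ≡ just x
    n4 x with τ-joint st x
    ... | inj₁ (x' , p) = inj₁ (fV (Iso.to φ) x' , trans (cong (fV e) (Iso.invV₁ φ x')) p)
    ... | inj₂ q = inj₂ q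
    e2 : ∀ v → ¬ InImgE ιm v → ∃ λ x → τE st v ≡ just x × ¬ InImgE (InjMorph.mor em') x
    e2 v nv = let (x , ex , nx) = τE-outside st v nv in x , ex , λ { (a , p) → nx (fE (Iso.from φ) a , p) }
    e4 : ∀ x → InImgE (InjMorph.mor em') x ⊎ ∃ λ v → ¬ InImgE ιm v × τE st v ≡ just x
    e4 x with τE-joint st x
    ... | inj₁ (x' , p) = inj₁ (fE (Iso.to φ) x' , trans (cong (fE e) (Iso.invE₁ φ x')) p)
    ... | inj₂ q = inj₂ q

  extendSequence : ∀ {X' M'} (p : _⇒*_ T X' M') {X} (st : Embedded X' X) →
          (∀ u x → Boundary u → τ' st u ≡ just x → ∃ λ y → trackV* T p x ≡ just y) →
          Σ (Graph A) λ M → (_⇒*_ T X M) × Σ (Embedded M' M) λ st' → ∀ u → τ' st' u ≡ (τ' st u >>= trackV* T p)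
  extendSequence (done φ) {X} st safe = X , done (idIso X) , embeddingAlongIso st φ , λ u → refl
  extendSequence (step (i , d') q) {X} st safe =
    let module E = ExtendStep st d' safe1
        (M , pq , st2 , eq) = extendSequence q E.st' safe2
    in M , step (i , E.d) pq , st2 , λ u → trans (eq u) (bind-assoc (τ' st u) (trV d') (trackV* T q))
    where
    safe1 : ∀ u x → Boundary u → τ' st u ≡ just x → ∃ λ y → trV d' x ≡ just y
    safe1 u x b ex with trV d' x in et | safe u x b ex
    ... | just y | _ = y , refl
    ... | nothing | (z , ez) = ⊥-elim (just≢nothing (sym ez))
    safe2 : ∀ u y → Boundary u → (τ' st u >>= trV d') ≡ just y → ∃ λ z → trackV* T q y ≡ just z
    safe2 u y b ey with bind-inv (τ' st u) (trV d') ey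
    ... | (x , ex , tx) = let (z , ez) = safe u x b ex in z , trans (sym (cong (_>>= trackV* T q) tx)) ez

gate : ∀ {P X : Set} → Dec P → Maybe X → Maybe X
gate (yes _) m = m
gate (no _) m = nothing

gateInv : ∀ {P X : Set} (d : Dec P) (m : Maybe X) {x} → gate d m ≡ just x → P × m ≡ just x
gateInv (yes p) m e = p , e

gateYes : ∀ {P X : Set} (d : Dec P) (m : Maybe X) → P → gate d m ≡ m
gateYes (yes _) m p = refl
gateYes (no n) m p = ⊥-elim (n p)

gateN : ∀ {P X : Set} → Dec P → Maybe X → Maybe X
gateN (yes _) m = nothing
gateN (no _) m = m

gateNInv : ∀ {P X : Set} (d : Dec P) (m : Maybe X) {x} → gateN d m ≡ just x → ¬ P × m ≡ just x
gateNInv (no n) m e = n , e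

gateNNo : ∀ {P X : Set} (d : Dec P) (m : Maybe X) → ¬ P → gateN d m ≡ m
gateNNo (yes p) m n = ⊥-elim (n p)
gateNNo (no _) m n = refl

-- Two extensions of derivations from G' whose small sides agree on the boundary
-- lead to isomorphic graphs: describe each result by M' and by the Good nodes of G
-- (the context and the agreeing boundary), which make the same identifications.
module CompareExtensions {A : Alphabet} (T : GTS A) {G G' : Graph A} (ι : InjMorph G' G)
   (Good : Node G → Set) (good? : ∀ v → Dec (Good v)) where
  open Context T ι

  SF : Graph A → Bool → Graph A
  SF M' true = M'
  SF M' false = G

  inI? : ∀ v → Dec (InImgV ιm v)
  inI? v = any? (λ u → fV ιm u ≟ v)
  inIE? : ∀ c → Dec (InImgE ιm c)
  inIE? c = any? (λ u → fE ιm u ≟ c)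

  module _ (ctxGood : ∀ v → ¬ InImgV ιm v → Good v) (bndGood : ∀ u → Boundary u → Good (fV ιm u)) where

    goodS : ∀ c → ¬ InImgE ιm c → Good (s G c)
    goodS c nc with inI? (s G c)
    ... | no n = ctxGood _ n
    ... | yes (u , e) = subst Good e (bndGood u (c , nc , inj₁ (sym e)))
    goodT : ∀ c → ¬ InImgE ιm c → Good (t G c)
    goodT c nc with inI? (t G c)
    ... | no n = ctxGood _ n
    ... | yes (u , e) = subst Good e (bndGood u (c , nc , inj₂ (sym e)))

    descSt : ∀ {M' M} → Embedded M' M → Description Bool (SF M') M
    descSt {M'} {M} S = record { pV = pv ; pE = pe ; ps = λ {j} {a} → ps' {j} {a} ; pt = λ {j} {a} → pt' {j} {a}
                               ; plV = λ {j} {a} → plv {j} {a} ; plE = λ {j} {a} → ple {j} {a} }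
      where
      e = InjMorph.mor (em S)
      pv : (j : Bool) → Node (SF M' j) → Maybe (Node M)
      pv true a = just (fV e a)
      pv false v = gate (good? v) (τ S v)
      pe : (j : Bool) → Edge (SF M' j) → Maybe (Edge M)
      pe true a = just (fE e a)
      pe false c = gateN (inIE? c) (τE S c)
      ps' : ∀ {j a f} → pe j a ≡ just f → pv j (s (SF M' j) a) ≡ just (s M f)
      ps' {true} {a} eq = trans (cong just (pres-s e a)) (cong (λ z → just (s M z)) (just-injective eq))
      ps' {false} {c} eq = let (nc , ec) = gateNInv (inIE? c) (τE S c) eq
                           in trans (gateYes (good? _) _ (goodS c nc)) (τE-s S ec)
      pt' : ∀ {j a f} → pe j a ≡ just f → pv j (t (SF M' j) a) ≡ just (t M f)
      pt' {true} {a} eq = trans (cong just (pres-t e a)) (cong (λ z → just (t M z)) (just-injective eq))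
      pt' {false} {c} eq = let (nc , ec) = gateNInv (inIE? c) (τE S c) eq
                           in trans (gateYes (good? _) _ (goodT c nc)) (τE-t S ec)
      plv : ∀ {j a x} → pv j a ≡ just x → lV M x ≡ lV (SF M' j) a
      plv {true} {a} eq = trans (cong (lV M) (sym (just-injective eq))) (pres-lV e a)
      plv {false} {v} eq = τ-label S (proj₂ (gateInv (good? v) (τ S v) eq))
      ple : ∀ {j a x} → pe j a ≡ just x → lE M x ≡ lE (SF M' j) a
      ple {true} {a} eq = trans (cong (lE M) (sym (just-injective eq))) (pres-lE e a)
      ple {false} {c} eq = τE-label S (proj₂ (gateNInv (inIE? c) (τE S c) eq))

    coverSt : ∀ {M' M} (S : Embedded M' M) → Covers (descSt S)
    coverSt S = cv , ce
      where
      cv : ∀ x → _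
      cv x with τ-joint S x
      ... | inj₁ (a , ea) = true , a , cong just ea
      ... | inj₂ (v , nv , ev) = false , v , trans (gateYes (good? v) _ (ctxGood v nv)) ev
      ce : ∀ x → _
      ce x with τE-joint S x
      ... | inj₁ (a , ea) = true , a , cong just ea
      ... | inj₂ (c , nc , ec) = false , c , trans (gateNNo (inIE? c) _ nc) ec

    module Cp {M' M1 M2} (S1 : Embedded M' M1) (S2 : Embedded M' M2)
        (agree : ∀ u → Good (fV ιm u) → ∃ λ w → τ' S1 u ≡ just w × τ' S2 u ≡ just w) where
      e1 = InjMorph.mor (em S1)
      e2 = InjMorph.mor (em S2)
      p = descSt S1
      q = descSt S2

      def2 : ∀ v → Good v → ∃ λ y → τ S2 v ≡ just y
      def2 v gv with inI? v
      ... | no n = let (x , ex , _) = τ-outside S2 v n in x , ex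
      ... | yes (u , refl) = let (w , _ , ew) = agree u gv in fV e2 w , trans (τ-ι S2 u) (cong (_>>= _) ew)

      mixed : ∀ v a {x} → pV p false v ≡ just x → fV e1 a ≡ x → pV q false v ≡ just (fV e2 a)
      mixed v a {x} ev ea with gateInv (good? v) (τ S1 v) ev
      ... | (gv , τv) with inI? v
      ...   | no n = ⊥-elim (let (x' , ex' , nx') = τ-outside S1 v n in nx' (a , trans ea (just-injective (trans (sym τv) ex'))))
      ...   | yes (u , refl) =
                let (w , ew , ew2) = agree u gv
                    h1 : τ S1 (fV ιm u) ≡ just (fV e1 w)
                    h1 = trans (τ-ι S1 u) (cong (_>>= _) ew)
                    w≡a : w ≡ a
                    w≡a = InjMorph.injV (em S1) (just-injective (trans (sym h1) (trans τv (sym (cong just ea)))))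
                in trans (gateYes (good? _) _ gv) (trans (τ-ι S2 u) (trans (cong (_>>= _) ew2) (cong (λ z → just (fV e2 z)) w≡a)))

      cv : ∀ j a k b {x} → pV p j a ≡ just x → pV p k b ≡ just x → ∃ λ y → pV q j a ≡ just y × pV q k b ≡ just y
      cv true a true b ea eb with InjMorph.injV (em S1) (just-injective (trans ea (sym eb)))
      ... | refl = fV e2 a , refl , refl
      cv false v false v' ev ev' with gateInv (good? v) (τ S1 v) ev | gateInv (good? v') (τ S1 v') ev'
      ... | (gv , τv) | (gv' , τv') with τ-injective S1 τv τv'
      ... | refl = let (y , ey) = def2 v gv in y , trans (gateYes (good? v) _ gv) ey , trans (gateYes (good? v) _ gv) ey
      cv false v true a ev ea = fV e2 a , mixed v a ev (just-injective ea) , refl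
      cv true a false v ea ev = fV e2 a , refl , mixed v a ev (just-injective ea)

      ce : ∀ j a k b {x} → pE p j a ≡ just x → pE p k b ≡ just x → ∃ λ y → pE q j a ≡ just y × pE q k b ≡ just y
      ce true a true b ea eb with InjMorph.injE (em S1) (just-injective (trans ea (sym eb)))
      ... | refl = fE e2 a , refl , refl
      ce false c false c' ec ec' with gateNInv (inIE? c) (τE S1 c) ec | gateNInv (inIE? c') (τE S1 c') ec'
      ... | (nc , τc) | (nc' , τc') with τE-injective S1 τc τc'
      ... | refl = let (y , ey , _) = τE-outside S2 c nc in y , trans (gateNNo (inIE? c) _ nc) ey , trans (gateNNo (inIE? c) _ nc) ey
      ce false c true a ec ea = ⊥-elim (let (nc , τc) = gateNInv (inIE? c) (τE S1 c) ec
                                            (y , ey , ny) = τE-outside S1 c nc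
                                        in ny (a , just-injective (trans ea (trans (sym τc) ey))))
      ce true a false c ea ec = ⊥-elim (let (nc , τc) = gateNInv (inIE? c) (τE S1 c) ec
                                            (y , ey , ny) = τE-outside S1 c nc
                                        in ny (a , just-injective (trans ea (trans (sym τc) ey))))

      compat : Compatible p q
      compat = (λ {j} {a} {k} {b} → cv j a k b) , (λ {j} {a} {k} {b} → ce j a k b)

    extensionsIso : ∀ {M' M1 M2} (S1 : Embedded M' M1) (S2 : Embedded M' M2) →
        (∀ u → Good (fV ιm u) → ∃ λ w → τ' S1 u ≡ just w × τ' S2 u ≡ just w) → Iso M1 M2
    extensionsIso S1 S2 agree =
      descriptionIso (descSt S1) (coverSt S1) (descSt S2) (coverSt S2)
        (Cp.compat S1 S2 agree) (Cp.compat S2 S1 (λ u g → let (w , a , b) = agree u g in w , b , a))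

module _ {A : Alphabet} (T : GTS A) where

  DistinctSteps : ∀ {G H₁ H₂ i₁ i₂} → DDer (rule T i₁) G H₁ → DDer (rule T i₂) G H₂ → Set
  DistinctSteps {G} {i₁ = i₁} {i₂} d₁ d₂ = (p : i₁ ≡ i₂) → ¬ SameMorph (subst (λ j → Morph (L (rule T j)) G) p (g d₁)) (g d₂)

  sameOrDistinct : ∀ {G H₁ H₂ i₁ i₂} (d₁ : DDer (rule T i₁) G H₁) (d₂ : DDer (rule T i₂) G H₂) →
                   (Σ (i₁ ≡ i₂) λ p → SameMorph (subst (λ j → Morph (L (rule T j)) G) p (g d₁)) (g d₂))
                   ⊎ DistinctSteps d₁ d₂
  sameOrDistinct {i₁ = i₁} {i₂} d₁ d₂ with i₁ ≟ i₂
  ... | no i₁≢i₂ = inj₂ (λ p → ⊥-elim (i₁≢i₂ p))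
  ... | yes refl with all? (λ x → fV (g d₁) x ≟ fV (g d₂) x) | all? (λ x → fE (g d₁) x ≟ fE (g d₂) x)
  ...   | yes sv | yes se = inj₁ (refl , sv , se)
  ...   | no ¬sv | _ = inj₂ λ { refl (sv , _) → ¬sv sv }
  ...   | yes _ | no ¬se = inj₂ λ { refl (_ , se) → ¬se se }

decJust : ∀ {X : Set} (m : Maybe X) → Dec (∃ λ w → m ≡ just w)
decJust (just x) = yes (x , refl)
decJust nothing = no λ { (_ , ()) }

-- Restrict both steps to the union G' of the match images: this is a critical
-- pair, non-garbage because G' ⊆ G ∈ D, so it is strongly joinable.  The joining
-- derivations preserve the boundary of G' (which consists of persistent nodes) and
-- extend to H₁ and H₂; strong joinability makes the extensions agree on the
-- boundary, hence their results are isomorphic.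
module CriticalOverlap {A : Alphabet} (T : GTS A) (D : Graph A → Set)
  (sj : (cp : CriticalPair T) → NonGarbageCP T D cp → StronglyJoinable T cp)
  {G H₁ H₂ : Graph A} (dG : D G) (i1 i2 : Fin (nR T))
  (d1 : DDer (rule T i1) G H₁) (d2 : DDer (rule T i2) G H₂)
  (confl : Conflict d1 d2)
  (dist : DistinctSteps T d1 d2) where

  g1 = g d1
  g2 = g d2

  PV : Node G → Set
  PV v = InImgV g1 v ⊎ InImgV g2 v
  PE : Edge G → Set
  PE e = InImgE g1 e ⊎ InImgE g2 e

  csE : (sel : ∀ {Z : Graph A} → Edge Z → Node Z)
        (psel : ∀ {Z W : Graph A} (f : Morph Z W) c → fV f (sel {Z} c) ≡ sel {W} (fE f c)) →
        ∀ e → PE e → PV (sel {G} e)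
  csE sel psel e (inj₁ (x , ex)) = inj₁ (sel x , trans (psel g1 x) (cong sel ex))
  csE sel psel e (inj₂ (x , ex)) = inj₂ (sel x , trans (psel g2 x) (cong sel ex))

  module SG = Subgraph G PV PE (λ v → any? (λ x → fV g1 x ≟ v) ⊎-dec any? (λ x → fV g2 x ≟ v))
                          (λ v → any? (λ x → fE g1 x ≟ v) ⊎-dec any? (λ x → fE g2 x ≟ v))
                          (csE (λ {Z} → s Z) (λ f → pres-s f)) (csE (λ {Z} → t Z) (λ f → pres-t f))
  G' = SG.S
  ι = SG.ι
  ιm = SG.ιm

  module Restrict {r : Rule A} {H : Graph A} (d : DDer r G H) (inV : ∀ x → PV (fV (g d) x)) (inE : ∀ x → PE (fE (g d) x)) where
    gg = g d
    gV : Node (L r) → Node G'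
    gV x = Enum.idx SG.EV (fV gg x) (inV x)
    gE : Edge (L r) → Edge G'
    gE x = Enum.idx SG.EE (fE gg x) (inE x)
    ιgV : ∀ x → fV ιm (gV x) ≡ fV gg x
    ιgV x = Enum.emb-idx SG.EV _ _
    ιgE : ∀ x → fE ιm (gE x) ≡ fE gg x
    ιgE x = Enum.emb-idx SG.EE _ _
    g' : Morph (L r) G'
    g' = record
      { fV = gV ; fE = gE
      ; pres-s = λ x → idx-irr SG.EV _ _ (trans (pres-s gg x) (cong (s G) (sym (ιgE x))))
      ; pres-t = λ x → idx-irr SG.EV _ _ (trans (pres-t gg x) (cong (t G) (sym (ιgE x))))
      ; pres-lV = λ x → trans (cong (lV G) (ιgV x)) (pres-lV gg x)
      ; pres-lE = λ x → trans (cong (lE G) (ιgE x)) (pres-lE gg x) }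
    injV' : Injective _≡_ _≡_ gV
    injV' {x} {y} p = g-injV d (trans (sym (ιgV x)) (trans (cong (fV ιm) p) (ιgV y)))
    injE' : Injective _≡_ _≡_ gE
    injE' {x} {y} p = g-injE d (trans (sym (ιgE x)) (trans (cong (fE ιm) p) (ιgE y)))
    kL = InjMorph.mor (kl r)
    delUp : ∀ u → (∃ λ y → ¬ InImgV kL y × gV y ≡ u) → DelV d (fV ιm u)
    delUp u (y , ny , ey) = y , ny , trans (sym (ιgV y)) (cong (fV ιm) ey)
    dang' : DanglingCondition r g'
    dang' e ne =
      let nimg : ¬ InImgE gg (fE ιm e)
          nimg = λ { (x , ex) → ne (x , InjMorph.injE ι (trans (ιgE x) ex)) }
          (a , b) = dangling d (fE ιm e) nimg
      in (λ dl → a (subst (DelV d) (pres-s ιm e) (delUp _ dl)))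
       , (λ dl → b (subst (DelV d) (pres-t ιm e) (delUp _ dl)))
    opaque
      B : Σ (Graph A) λ H → Σ (DDer r G' H) λ d → SameMorph (g d) g'
      B = derivationExists r G' g' injV' injE' dang'
    H' = proj₁ B
    d' : DDer r G' H'
    d' = proj₁ (proj₂ B)
    sV : ∀ x → fV (g d') x ≡ gV x
    sV = proj₁ (proj₂ (proj₂ B))
    sE : ∀ x → fE (g d') x ≡ gE x
    sE = proj₂ (proj₂ (proj₂ B))

  module R1 = Restrict d1 (λ x → inj₁ (x , refl)) (λ x → inj₁ (x , refl))
  module R2 = Restrict d2 (λ x → inj₂ (x , refl)) (λ x → inj₂ (x , refl))

  uV : ∀ v → InImgV (g R1.d') v ⊎ InImgV (g R2.d') v
  uV v with Enum.embP SG.EV v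
  ... | inj₁ (x , ex) = inj₁ (x , trans (R1.sV x) (InjMorph.injV ι (trans (R1.ιgV x) ex)))
  ... | inj₂ (x , ex) = inj₂ (x , trans (R2.sV x) (InjMorph.injV ι (trans (R2.ιgV x) ex)))
  uE : ∀ v → InImgE (g R1.d') v ⊎ InImgE (g R2.d') v
  uE v with Enum.embP SG.EE v
  ... | inj₁ (x , ex) = inj₁ (x , trans (R1.sE x) (InjMorph.injE ι (trans (R1.ιgE x) ex)))
  ... | inj₂ (x , ex) = inj₂ (x , trans (R2.sE x) (InjMorph.injE ι (trans (R2.ιgE x) ex)))


  cfV : (∃ λ v → InImgV g1 v × InImgV g2 v × ¬ PreservedByBothV d1 d2 v) →
        (∃ λ v → InImgV (g R1.d') v × InImgV (g R2.d') v × ¬ PreservedByBothV R1.d' R2.d' v)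
  cfV (v , (x , ex) , (y , ey) , nk) = R1.gV x , (x , R1.sV x) , (y , trans (R2.sV y) e2) , nk'
    where
    e2 : R2.gV y ≡ R1.gV x
    e2 = InjMorph.injV ι (trans (R2.ιgV y) (trans ey (trans (sym ex) (sym (R1.ιgV x)))))
    nk' : ¬ PreservedByBothV R1.d' R2.d' (R1.gV x)
    nk' ((a , ea') , (b , eb')) = let ea = trans (sym (R1.sV _)) ea' ; eb = trans (sym (R2.sV _)) eb' in
                                nk ((a , trans (sym (R1.ιgV _)) (trans (cong (fV ιm) ea) (trans (R1.ιgV x) ex)))
                                   , (b , trans (sym (R2.ιgV _)) (trans (cong (fV ιm) eb) (trans (R1.ιgV x) ex))))
  cfE : (∃ λ e → InImgE g1 e × InImgE g2 e × ¬ PreservedByBothE d1 d2 e) →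
        (∃ λ e → InImgE (g R1.d') e × InImgE (g R2.d') e × ¬ PreservedByBothE R1.d' R2.d' e)
  cfE (v , (x , ex) , (y , ey) , nk) = R1.gE x , (x , R1.sE x) , (y , trans (R2.sE y) e2) , nk'
    where
    e2 : R2.gE y ≡ R1.gE x
    e2 = InjMorph.injE ι (trans (R2.ιgE y) (trans ey (trans (sym ex) (sym (R1.ιgE x)))))
    nk' : ¬ PreservedByBothE R1.d' R2.d' (R1.gE x)
    nk' ((a , ea') , (b , eb')) = let ea = trans (sym (R1.sE _)) ea' ; eb = trans (sym (R2.sE _)) eb' in
                                nk ((a , trans (sym (R1.ιgE _)) (trans (cong (fE ιm) ea) (trans (R1.ιgE x) ex)))
                                   , (b , trans (sym (R2.ιgE _)) (trans (cong (fE ιm) eb) (trans (R1.ιgE x) ex))))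

  conf' : Conflict R1.d' R2.d'
  conf' = Sum.map cfV cfE confl

  dist' : DistinctSteps T R1.d' R2.d'
  dist' refl (sv , se) = dist refl ((λ x → trans (sym (R1.ιgV x)) (trans (cong (fV ιm) (trans (sym (R1.sV x)) (trans (sv x) (R2.sV x)))) (R2.ιgV x)))
                                   , (λ x → trans (sym (R1.ιgE x)) (trans (cong (fE ιm) (trans (sym (R1.sE x)) (trans (se x) (R2.sE x)))) (R2.ιgE x))))

  cp : CriticalPair T
  cp = record { i₁ = i1 ; i₂ = i2 ; G = G' ; H₁ = R1.H' ; H₂ = R2.H' ; d₁ = R1.d' ; d₂ = R2.d'
              ; unionV = uV ; unionE = uE ; conflict = conf' ; distinct = dist' }

  SJ = sj cp (G , dG , ι)
  M' = proj₁ SJ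
  p1 = proj₁ (proj₂ SJ)
  p2 = proj₁ (proj₂ (proj₂ SJ))
  agr = proj₂ (proj₂ (proj₂ SJ))

  Boundary = Context.Boundary T ι
  Embedded = Context.Embedded T ι
  τ' : ∀ {X' X} → Embedded X' X → Node G' → Maybe (Node X')
  τ' S = Context.Embedded.τ' S
  initialEmbedding = Context.initialEmbedding T ι

  -- boundary nodes are preserved by both steps (dangling condition in G), so they
  -- are persistent
  notDel1 : ∀ u → Boundary u → ¬ DelV R1.d' u
  notDel1 u (c , nc , sc) dl =
    let nimg : ¬ InImgE g1 c
        nimg = λ { (x , ex) → nc (SG.inE c (inj₁ (x , ex))) }
        (a , b) = dangling d1 c nimg
    in go a b sc (R1.delUp u (let (y , ny , ey) = dl in y , ny , trans (sym (R1.sV y)) ey))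
    where
    go : ¬ DelV d1 (s G c) → ¬ DelV d1 (t G c) → (s G c ≡ fV ιm u ⊎ t G c ≡ fV ιm u) → ¬ DelV d1 (fV ιm u)
    go a b (inj₁ e) = λ z → a (subst (DelV d1) (sym e) z)
    go a b (inj₂ e) = λ z → b (subst (DelV d1) (sym e) z)
  notDel2 : ∀ u → Boundary u → ¬ DelV R2.d' u
  notDel2 u (c , nc , sc) dl =
    let nimg : ¬ InImgE g2 c
        nimg = λ { (x , ex) → nc (SG.inE c (inj₂ (x , ex))) }
        (a , b) = dangling d2 c nimg
    in go a b sc (R2.delUp u (let (y , ny , ey) = dl in y , ny , trans (sym (R2.sV y)) ey))
    where
    go : ¬ DelV d2 (s G c) → ¬ DelV d2 (t G c) → (s G c ≡ fV ιm u ⊎ t G c ≡ fV ιm u) → ¬ DelV d2 (fV ιm u)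
    go a b (inj₁ e) = λ z → a (subst (DelV d2) (sym e) z)
    go a b (inj₂ e) = λ z → b (subst (DelV d2) (sym e) z)

  pers : ∀ u → Boundary u → Persistent T cp u
  pers u b = defined (trV R1.d' u) (λ e → notDel1 u b (trV-keep R1.d' u e))
           , defined (trV R2.d' u) (λ e → notDel2 u b (trV-keep R2.d' u e))

  safe1 : ∀ u x → Boundary u → τ' initialEmbedding u ≡ just x → ∃ λ y → trV R1.d' x ≡ just y
  safe1 u x b refl = proj₁ (pers u b)
  safe2 : ∀ u x → Boundary u → τ' initialEmbedding u ≡ just x → ∃ λ y → trV R2.d' x ≡ just y
  safe2 u x b refl = proj₂ (pers u b)

  extension₁ = Context.extendStep T ι initialEmbedding R1.d' safe1
  extension₂ = Context.extendStep T ι initialEmbedding R2.d' safe2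
  module Ext₁ = Context.Extension extension₁
  module Ext₂ = Context.Extension extension₂

  safeC1 : ∀ u x → Boundary u → τ' Ext₁.st' u ≡ just x → ∃ λ y → trackV* T p1 x ≡ just y
  safeC1 u x b ex = let (w , a , _) = agr u (pers u b) in w , trans (sym (cong (_>>= trackV* T p1) (trans (sym (Ext₁.τeq u)) ex))) a
  safeC2 : ∀ u x → Boundary u → τ' Ext₂.st' u ≡ just x → ∃ λ y → trackV* T p2 x ≡ just y
  safeC2 u x b ex = let (w , _ , a) = agr u (pers u b) in w , trans (sym (cong (_>>= trackV* T p2) (trans (sym (Ext₂.τeq u)) ex))) a

  C1 = Context.extendSequence T ι p1 Ext₁.st' safeC1
  C2 = Context.extendSequence T ι p2 Ext₂.st' safeC2
  M1 = proj₁ C1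
  M2 = proj₁ C2
  S1 : Embedded M' M1
  S1 = proj₁ (proj₂ (proj₂ C1))
  S2 : Embedded M' M2
  S2 = proj₁ (proj₂ (proj₂ C2))
  eqC1 : ∀ u → τ' S1 u ≡ (τ' Ext₁.st' u >>= trackV* T p1)
  eqC1 = proj₂ (proj₂ (proj₂ C1))
  eqC2 : ∀ u → τ' S2 u ≡ (τ' Ext₂.st' u >>= trackV* T p2)
  eqC2 = proj₂ (proj₂ (proj₂ C2))

  -- extending the restricted steps gives back the original ones up to isomorphism
  φ1 : Iso Ext₁.Y H₁
  φ1 = proj₁ (derivationUnique Ext₁.d d1 ((λ x → sym (trans (Ext₁.gsV x) (trans (cong (fV ιm) (R1.sV x)) (R1.ιgV x)))) , (λ x → sym (trans (Ext₁.gsE x) (trans (cong (fE ιm) (R1.sE x)) (R1.ιgE x))))))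
  φ2 : Iso Ext₂.Y H₂
  φ2 = proj₁ (derivationUnique Ext₂.d d2 ((λ x → sym (trans (Ext₂.gsV x) (trans (cong (fV ιm) (R2.sV x)) (R2.ιgV x)))) , (λ x → sym (trans (Ext₂.gsE x) (trans (cong (fE ιm) (R2.sE x)) (R2.ιgE x))))))

  Good : Node G → Set
  Good v = ¬ InImgV ιm v ⊎ ∃ λ u → fV ιm u ≡ v × Persistent T cp u
  good? : ∀ v → Dec (Good v)
  good? v = ¬? (any? (λ u → fV ιm u ≟ v)) ⊎-dec any? (λ u → (fV ιm u ≟ v) ×-dec (decJust (trV R1.d' u) ×-dec decJust (trV R2.d' u)))

  agree : ∀ u → Good (fV ιm u) → ∃ λ w → τ' S1 u ≡ just w × τ' S2 u ≡ just w
  agree u (inj₁ n) = ⊥-elim (n (u , refl))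
  agree u (inj₂ (u' , e , pu')) =
    let pu : Persistent T cp u
        pu = subst (Persistent T cp) (InjMorph.injV ι e) pu'
        (w , a , b) = agr u pu
    in w , trans (eqC1 u) (trans (cong (_>>= trackV* T p1) (Ext₁.τeq u)) a)
         , trans (eqC2 u) (trans (cong (_>>= trackV* T p2) (Ext₂.τeq u)) b)

  isoM : Iso M1 M2
  isoM = CompareExtensions.extensionsIso T ι Good good? (λ v n → inj₁ n) (λ u b → inj₂ (u , refl , pers u b)) S1 S2 agree

  result : ∃ λ M → (_⇒*_ T H₁ M) × (_⇒*_ T H₂ M)
  result = M1 , transportSequence T φ1 (proj₁ (proj₂ C1)) , _++*_ T (transportSequence T φ2 (proj₁ (proj₂ C2))) (done (symIso isoM))

module _ {A : Alphabet} (T : GTS A) (D : Graph A → Set)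
  (sj : (cp : CriticalPair T) → NonGarbageCP T D cp → StronglyJoinable T cp) where

  localConfluence : LocallyConfluent T D
  localConfluence dG (i₁ , d₁) (i₂ , d₂) with independentOrConflict d₁ d₂
  ... | inj₁ (indV , indE) = ParallelIndependence.result T i₁ i₂ d₁ d₂ indV indE
  ... | inj₂ conflict with sameOrDistinct T d₁ d₂
  ...   | inj₂ distinct = CriticalOverlap.result T D sj dG i₁ i₂ d₁ d₂ conflict distinct
  ...   | inj₁ (refl , sv , se) =
            _ , done (proj₁ (derivationUnique d₁ d₂ ((λ x → sym (sv x)) , (λ x → sym (se x))))) , done (idIso _)

mainTheorem17 : (A : Alphabet) (T : GTS A) (D : Graph A → Set) →
  IsoClosed T D →
  TerminatingModGarbage T D →
  WeaklyGarbageSeparating T D →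
  ((cp : CriticalPair T) → NonGarbageCP T D cp → StronglyJoinable T cp) →
  ConfluentModGarbage T D
mainTheorem17 A T D _ terminating wgs sj {G} dG p₁ p₂ =
  newman T D wgs (localConfluence T D sj) (terminating G dG) dG p₁ p₂
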